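{- Let $d_n$ be the number of equivalence classes of $n$-diagrams under the action of the dihedral group $D_{2n}$ of order $4n$ of symmetries of the circuit $\Delta_{2n}$ (generated by $j\mapsto j+1\pmod{2n}$ and $j\mapsto 2n+1-j$ on $[2n]$). Then \[ d_n \sim \frac{(2n-1)!!}{4n} \quad\text{as } n\to\infty . \]
   Context: A chord diagram of order $n$ (an $n$-diagram) is a 3-regular graph on the vertex set $[2n]=\{1,\dots,2n\}$ containing the $2n$-circuit $\Delta_{2n}=(1\,2\,\dots\,2n)$ as a subgraph; the edges not in the circuit are called chords (they form a perfect matching of $[2n]$). If a group $G$ of permutations of $[2n]$ acts on $\Delta_{2n}$, two $n$-diagrams $\Gamma_1,\Gamma_2$ are equivalent if some $g\in G$ maps the set of chords of $\Gamma_1$ onto the set of chords of $\Gamma_2$. -}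

module Defs where

open import Data.Nat using (ℕ; zero; suc; _+_; _*_; _≤_; ∣_-_∣)
open import Data.Nat.DivMod using (_%_; m%n<n)
open import Data.Fin using (Fin; toℕ; fromℕ<; opposite)
open import Data.Bool using (Bool; true; false)
open import Data.Product using (Σ; _×_; ∃)
open import Data.Vec using (Vec; lookup)
open import Relation.Binary.PropositionalEquality using (_≡_; _≢_)
open import Relation.Nullary using (¬_)

-- Vertices of Δ_{2n}: Fin (2 * n), vertex j (0-indexed) is j+1 of the paper.
V : ℕ → Set
V n = Fin (2 * n)

-- An n-diagram is determined by its set of chords, a perfect matching of
-- the vertices; we encode it as a fixed-point-free involution μ
-- (the chords are the pairs {i , μ i}).
Diagram : ℕ → Set
Diagram n = Σ (V n → V n) (λ μ → (i : V n) → (μ (μ i) ≡ i) × (μ i ≢ i))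

rot : {k : ℕ} → ℕ → Fin k → Fin k
rot {zero} a ()
rot {suc k} a j = fromℕ< (m%n<n (toℕ j + a) (suc k))

-- The dihedral group D_{2n} of order 4n: elements r^a s^b with a ∈ Fin (2n),
-- b ∈ Bool; s is the reflection j ↦ 2n-1-j (0-indexed), i.e. j ↦ 2n+1-j on [2n].
Dihedral : ℕ → Set
Dihedral n = V n × Bool

act : {n : ℕ} → Dihedral n → V n → V n
act (a Data.Product., false) j = rot (toℕ a) j
act (a Data.Product., true)  j = rot (toℕ a) (opposite j)

-- Γ₁ ~ Γ₂ iff some g ∈ D_{2n} maps the chord set of Γ₁ onto that of Γ₂,
-- i.e. g maps each chord {i, μ₁ i} to the chord {g i, μ₂ (g i)}.
Equivalent : (n : ℕ) → Diagram n → Diagram n → Set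
Equivalent n (μ₁ Data.Product., _) (μ₂ Data.Product., _) =
  ∃ λ (g : Dihedral n) → (i : V n) → act {n} g (μ₁ i) ≡ μ₂ (act {n} g i)

-- "d_n = k": there are exactly k equivalence classes, witnessed by k pairwise
-- inequivalent representatives such that every diagram is equivalent to one.
ClassCount : ℕ → ℕ → Set
ClassCount n k = Σ (Vec (Diagram n) k) λ reps →
  ((i j : Fin k) → i ≢ j → ¬ Equivalent n (lookup reps i) (lookup reps j)) ×
  ((Γ : Diagram n) → ∃ λ (i : Fin k) → Equivalent n Γ (lookup reps i))

oddDoubleFact : ℕ → ℕ
oddDoubleFact zero = 1
oddDoubleFact (suc n) = (2 * n + 1) * oddDoubleFact n

module Submission where

-- A diagram is a fixed-point-free involution μ of ℤ/2n; there are (2n−1)!! of them, and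
-- D_{2n} acts by conjugation. Every class has at most 4n members, so (2n−1)!! ≤ 4n d_n.
-- Conversely, a class whose representative has trivial stabiliser has exactly 4n members,
-- and a representative with a non-trivial symmetry g has a short code: if a power of g is a
-- rotation through 0 < p ≤ 2n/3, μ is determined by its values at the first p vertices;
-- otherwise g is the half turn or a reflection, rotation-conjugate to one of two standard
-- ones, and μ is determined by an involution of at most n + 1 points and n + 1 bits.
-- Hence 4n d_n ≤ (2n−1)!! + 4n S_n with S_n ≤ poly(n) (16(n+2))^((n+1)/2) + (2n)^(2n/3+1),
-- which is o((2n−1)!!/n) since (2n−1)!! ≥ (2j+1)^(n−j) for j = ⌊n/8⌋.

open import Defs
open import Data.Nat using (ℕ; suc; _*_; _≤_; ∣_-_∣; _<_)
open import Data.Product using (∃)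
open import Algebra.Definitions using (Involutive)
open import Data.Fin using (Fin; toℕ)
open import Data.Sum using (_⊎_)
open import Relation.Binary.PropositionalEquality using (_≡_)

module Involutions where

  open import Algebra.Definitions using (Involutive)
  open import Data.Empty using (⊥-elim)
  open import Data.Fin using (Fin; zero; suc; _↑ˡ_; _↑ʳ_; combine; remQuot; splitAt)
  open import Data.Fin.Permutation.Components using (transpose)
  open import Data.Fin.Properties using (_≟_; suc-injective; combine-injective; combine-remQuot; ↑ˡ-injective; ↑ʳ-injective; splitAt-↑ˡ; splitAt-↑ʳ)
  open import Data.Nat using (ℕ; zero; suc; _+_; _*_)
  open import Data.Product using (Σ; _×_; _,_; proj₁; proj₂; uncurry)
  open import Data.Product.Properties using (×-≡,≡→≡)
  open import Relation.Binary.PropositionalEquality using (_≡_; _≢_; _≗_; refl; sym; trans; cong; module ≡-Reasoning)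
  open import Relation.Nullary using (Dec; yes; no)

  Endo : ℕ → Set
  Endo K = Fin K → Fin K

  FixedPointFree : {K : ℕ} → Endo K → Set
  FixedPointFree f = ∀ x → f x ≢ x

  Commute : {K : ℕ} → Endo K → Endo K → Set
  Commute f g = ∀ x → f (g x) ≡ g (f x)

  commute-sym : {K : ℕ} {f g : Endo K} → Commute f g → Commute g f
  commute-sym fg≡gf x = sym (fg≡gf x)

  FPFInvolution : ℕ → Set
  FPFInvolution K = Σ (Endo K) λ f → Involutive _≡_ f × FixedPointFree f

  matchingCount : ℕ → ℕ
  matchingCount zero = 1
  matchingCount (suc zero) = 0
  matchingCount (suc (suc K)) = suc K * matchingCount K

  involutionCount : ℕ → ℕ
  involutionCount zero = 1
  involutionCount (suc zero) = 1
  involutionCount (suc (suc K)) = involutionCount (suc K) + suc K * involutionCount K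

  predOfNonZero : {K : ℕ} (x : Fin (suc K)) → x ≢ zero → Fin K
  predOfNonZero zero x≢0 = ⊥-elim (x≢0 refl)
  predOfNonZero (suc c) _ = c

  suc-predOfNonZero : {K : ℕ} (x : Fin (suc K)) (x≢0 : x ≢ zero) → suc (predOfNonZero x x≢0) ≡ x
  suc-predOfNonZero zero x≢0 = ⊥-elim (x≢0 refl)
  suc-predOfNonZero (suc c) _ = refl

  module _ {K : ℕ} (i j : Fin K) where

    transpose-left : transpose i j i ≡ j
    transpose-left with i ≟ i
    ... | yes _ = refl
    ... | no i≢i = ⊥-elim (i≢i refl)

    transpose-right : transpose i j j ≡ i
    transpose-right with j ≟ i
    ... | yes j≡i = j≡i
    ... | no _ with j ≟ j
    ...   | yes _ = refl
    ...   | no j≢j = ⊥-elim (j≢j refl)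

    transpose-other : ∀ {k} → k ≢ i → k ≢ j → transpose i j k ≡ k
    transpose-other {k} k≢i k≢j with k ≟ i
    ... | yes k≡i = ⊥-elim (k≢i k≡i)
    ... | no _ with k ≟ j
    ...   | yes k≡j = ⊥-elim (k≢j k≡j)
    ...   | no _ = refl

  transpose-involutive : {K : ℕ} (i j : Fin K) → Involutive _≡_ (transpose i j)
  transpose-involutive i j k with k ≟ i
  ... | yes refl = transpose-right k j
  ... | no k≢i with k ≟ j
  ...   | yes refl = transpose-left i k
  ...   | no k≢j = transpose-other i j k≢i k≢j

  module _ {K : ℕ} {f g : Endo K} (f≗g : f ≗ g) where

    involutive-resp-≗ : Involutive _≡_ f → Involutive _≡_ g
    involutive-resp-≗ f-inv x = trans (sym (trans (f≗g (f x)) (cong g (f≗g x)))) (f-inv x)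

    fixedPointFree-resp-≗ : FixedPointFree f → FixedPointFree g
    fixedPointFree-resp-≗ f-fpf x gx≡x = f-fpf x (trans (f≗g x) gx≡x)

    commute-respʳ-≗ : ∀ {h} → Commute h f → Commute h g
    commute-respʳ-≗ {h} hf≡fh x = trans (cong h (sym (f≗g x))) (trans (hf≡fh x) (f≗g (h x)))

  module Conjugation {K : ℕ} (π π⁻¹ : Endo K) (π∘π⁻¹ : ∀ x → π (π⁻¹ x) ≡ x) (π⁻¹∘π : ∀ x → π⁻¹ (π x) ≡ x) where

    conj : Endo K → Endo K
    conj f x = π (f (π⁻¹ x))

    unconj : Endo K → Endo K
    unconj f x = π⁻¹ (f (π x))

    conj-involutive : ∀ f → Involutive _≡_ f → Involutive _≡_ (conj f)
    conj-involutive f f-inv x = trans (cong π (trans (cong f (π⁻¹∘π (f (π⁻¹ x)))) (f-inv (π⁻¹ x)))) (π∘π⁻¹ x)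

    conj-fixedPointFree : ∀ f → FixedPointFree f → FixedPointFree (conj f)
    conj-fixedPointFree f f-fpf x πfπ⁻¹x≡x = f-fpf (π⁻¹ x) (trans (sym (π⁻¹∘π (f (π⁻¹ x)))) (cong π⁻¹ πfπ⁻¹x≡x))

    conj-cong : ∀ {f g} → f ≗ g → conj f ≗ conj g
    conj-cong f≗g x = cong π (f≗g (π⁻¹ x))

    unconj-conj : ∀ f → unconj (conj f) ≗ f
    unconj-conj f x = trans (π⁻¹∘π (f (π⁻¹ (π x)))) (cong f (π⁻¹∘π x))

    conj-injective : ∀ {f g} → conj f ≗ conj g → f ≗ g
    conj-injective {f} {g} eq x = trans (sym (unconj-conj f x)) (trans (cong π⁻¹ (eq (π x))) (unconj-conj g x))

    conj-commute : ∀ f g → Commute f g → Commute (conj f) (conj g)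
    conj-commute f g fg≡gf x = cong π (trans (cong f (π⁻¹∘π (g (π⁻¹ x)))) (trans (fg≡gf (π⁻¹ x)) (cong g (sym (π⁻¹∘π (f (π⁻¹ x)))))))

  fixZero : {K : ℕ} → Endo K → Endo (suc K)
  fixZero f zero = zero
  fixZero f (suc x) = suc (f x)

  dropZero : {K : ℕ} → Endo (suc K) → Endo K
  dropZero f x with f (suc x)
  ... | zero = x
  ... | suc y = y

  pairZeroOne : {K : ℕ} → Endo K → Endo (suc (suc K))
  pairZeroOne f zero = suc zero
  pairZeroOne f (suc zero) = zero
  pairZeroOne f (suc (suc x)) = suc (suc (f x))

  dropZeroOne : {K : ℕ} → Endo (suc (suc K)) → Endo K
  dropZeroOne f x with f (suc (suc x))
  ... | zero = x
  ... | suc zero = x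
  ... | suc (suc y) = y

  module _ {K : ℕ} (f : Endo (suc K)) (f-inv : Involutive _≡_ f) (f0≡0 : f zero ≡ zero) where

    fixZero-dropZero : f ≗ fixZero (dropZero f)
    fixZero-dropZero zero = f0≡0
    fixZero-dropZero (suc x) with f (suc x) in eq
    ... | zero with () ← trans (sym (f-inv (suc x))) (trans (cong f eq) f0≡0)
    ... | suc y = refl

  fixZero-cong : {K : ℕ} {f g : Endo K} → f ≗ g → fixZero f ≗ fixZero g
  fixZero-cong f≗g zero = refl
  fixZero-cong f≗g (suc x) = cong suc (f≗g x)

  dropZero-involutive : {K : ℕ} (f : Endo (suc K)) → Involutive _≡_ f → f zero ≡ zero → Involutive _≡_ (dropZero f)
  dropZero-involutive f f-inv f0≡0 x =
    suc-injective (involutive-resp-≗ (fixZero-dropZero f f-inv f0≡0) f-inv (suc x))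

  module _ {K : ℕ} (f : Endo (suc (suc K))) (f-inv : Involutive _≡_ f) (f0≡1 : f zero ≡ suc zero) where

    pairZeroOne-dropZeroOne : f ≗ pairZeroOne (dropZeroOne f)
    pairZeroOne-dropZeroOne zero = f0≡1
    pairZeroOne-dropZeroOne (suc zero) = trans (cong f (sym f0≡1)) (f-inv zero)
    pairZeroOne-dropZeroOne (suc (suc x)) with f (suc (suc x)) in eq
    ... | zero with () ← trans (sym (f-inv (suc (suc x)))) (trans (cong f eq) f0≡1)
    ... | suc zero with () ← trans (sym (f-inv (suc (suc x)))) (trans (cong f (trans eq (sym f0≡1))) (f-inv zero))
    ... | suc (suc y) = refl

    dropZeroOne-involutive : Involutive _≡_ (dropZeroOne f)
    dropZeroOne-involutive x = suc-injective (suc-injective (involutive-resp-≗ pairZeroOne-dropZeroOne f-inv (suc (suc x))))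

    dropZeroOne-fixedPointFree : FixedPointFree f → FixedPointFree (dropZeroOne f)
    dropZeroOne-fixedPointFree f-fpf x gx≡x = fixedPointFree-resp-≗ pairZeroOne-dropZeroOne f-fpf (suc (suc x)) (cong (λ y → suc (suc y)) gx≡x)

  pairZeroOne-involutive : {K : ℕ} {f : Endo K} → Involutive _≡_ f → Involutive _≡_ (pairZeroOne f)
  pairZeroOne-involutive f-inv zero = refl
  pairZeroOne-involutive f-inv (suc zero) = refl
  pairZeroOne-involutive f-inv (suc (suc x)) = cong (λ y → suc (suc y)) (f-inv x)

  pairZeroOne-fixedPointFree : {K : ℕ} {f : Endo K} → FixedPointFree f → FixedPointFree (pairZeroOne f)
  pairZeroOne-fixedPointFree f-fpf (suc (suc x)) eq = f-fpf x (suc-injective (suc-injective eq))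

  pairZeroOne-cong : {K : ℕ} {f g : Endo K} → f ≗ g → pairZeroOne f ≗ pairZeroOne g
  pairZeroOne-cong f≗g zero = refl
  pairZeroOne-cong f≗g (suc zero) = refl
  pairZeroOne-cong f≗g (suc (suc x)) = cong (λ y → suc (suc y)) (f≗g x)

  -- A matching of 2 + K points is the partner c + 1 of 0 together with a matching of the
  -- remaining K points, relabelled by the transposition 1 ↔ c + 1.
  swapOneWith : {K : ℕ} → Fin (suc K) → Endo (suc (suc K))
  swapOneWith c = transpose (suc zero) (suc c)

  module SwapOneWith {K : ℕ} (c : Fin (suc K)) =
    Conjugation (swapOneWith c) (swapOneWith c) (transpose-involutive _ _) (transpose-involutive _ _)

  swapOneWith-zero : {K : ℕ} (c : Fin (suc K)) → swapOneWith c zero ≡ zero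
  swapOneWith-zero c = transpose-other (suc zero) (suc c) (λ ()) (λ ())

  matchZeroTo : {K : ℕ} → Fin (suc K) → Endo K → Endo (suc (suc K))
  matchZeroTo c μ = SwapOneWith.conj c (pairZeroOne μ)

  residual : {K : ℕ} → Endo (suc (suc K)) → Fin (suc K) → Endo K
  residual f c = dropZeroOne (SwapOneWith.conj c f)

  module _ {K : ℕ} (c : Fin (suc K)) where
    open SwapOneWith c

    matchZeroTo-zero : (μ : Endo K) → matchZeroTo c μ zero ≡ suc c
    matchZeroTo-zero μ = trans (cong (λ y → swapOneWith c (pairZeroOne μ y)) (swapOneWith-zero c)) (transpose-left (suc zero) (suc c))

    matchZeroTo-involutive : ∀ {μ : Endo K} → Involutive _≡_ μ → Involutive _≡_ (matchZeroTo c μ)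
    matchZeroTo-involutive {μ} μ-inv = conj-involutive (pairZeroOne μ) (pairZeroOne-involutive μ-inv)

    matchZeroTo-fixedPointFree : ∀ {μ : Endo K} → FixedPointFree μ → FixedPointFree (matchZeroTo c μ)
    matchZeroTo-fixedPointFree {μ} μ-fpf = conj-fixedPointFree (pairZeroOne μ) (pairZeroOne-fixedPointFree μ-fpf)

    module _ (f : Endo (suc (suc K))) (f-inv : Involutive _≡_ f) (f0≡c : f zero ≡ suc c) where

      private
        conj-f-zero : conj f zero ≡ suc zero
        conj-f-zero = begin
          swapOneWith c (f (swapOneWith c zero)) ≡⟨ cong (λ y → swapOneWith c (f y)) (swapOneWith-zero c) ⟩
          swapOneWith c (f zero)                 ≡⟨ cong (swapOneWith c) f0≡c ⟩
          swapOneWith c (suc c)                  ≡⟨ transpose-right (suc zero) (suc c) ⟩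
          suc zero                               ∎
          where open ≡-Reasoning

      matchZeroTo-residual : f ≗ matchZeroTo c (residual f c)
      matchZeroTo-residual x = begin
        f x                                  ≡⟨ unconj-conj f x ⟨
        conj (conj f) x                      ≡⟨ conj-cong (pairZeroOne-dropZeroOne (conj f) (conj-involutive f f-inv) conj-f-zero) x ⟩
        conj (pairZeroOne (residual f c)) x  ∎
        where open ≡-Reasoning

      residual-involutive : Involutive _≡_ (residual f c)
      residual-involutive = dropZeroOne-involutive (conj f) (conj-involutive f f-inv) conj-f-zero

      residual-fixedPointFree : FixedPointFree f → FixedPointFree (residual f c)
      residual-fixedPointFree f-fpf = dropZeroOne-fixedPointFree (conj f) (conj-involutive f f-inv) conj-f-zero (conj-fixedPointFree f f-fpf)

  matchZeroTo-cong : {K : ℕ} {c c′ : Fin (suc K)} {μ μ′ : Endo K} → c ≡ c′ → μ ≗ μ′ → matchZeroTo c μ ≗ matchZeroTo c′ μ′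
  matchZeroTo-cong {c = c} refl μ≗μ′ = SwapOneWith.conj-cong c (pairZeroOne-cong μ≗μ′)

  matchZeroTo-injective : {K : ℕ} {c c′ : Fin (suc K)} {μ μ′ : Endo K} →
                          matchZeroTo c μ ≗ matchZeroTo c′ μ′ → c ≡ c′ × μ ≗ μ′
  matchZeroTo-injective {c = c} {c′} {μ} {μ′} eq with suc-injective (trans (sym (matchZeroTo-zero c μ)) (trans (eq zero) (matchZeroTo-zero c′ μ′)))
  ... | refl = refl , λ x → suc-injective (suc-injective (SwapOneWith.conj-injective c {pairZeroOne μ} {pairZeroOne μ′} eq (suc (suc x))))

  fin1-unique : (x y : Fin 1) → x ≡ y
  fin1-unique zero zero = refl

  partnerOfZero : {K : ℕ} (f : Endo (suc (suc K))) → FixedPointFree f → Fin (suc K)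
  partnerOfZero f f-fpf = predOfNonZero (f zero) (f-fpf zero)

  encodeMatching : (K : ℕ) (f : Endo K) → Involutive _≡_ f → FixedPointFree f → Fin (matchingCount K)
  encodeMatching zero f f-inv f-fpf = zero
  encodeMatching (suc zero) f f-inv f-fpf = ⊥-elim (f-fpf zero (fin1-unique _ _))
  encodeMatching (suc (suc K)) f f-inv f-fpf = combine c (encodeMatching K (residual f c)
    (residual-involutive c f f-inv f0≡c) (residual-fixedPointFree c f f-inv f0≡c f-fpf))
    where
      c = partnerOfZero f f-fpf
      f0≡c = sym (suc-predOfNonZero (f zero) (f-fpf zero))

  encodeMatching-injective : (K : ℕ) (f g : Endo K) (f-inv : Involutive _≡_ f) (f-fpf : FixedPointFree f)
    (g-inv : Involutive _≡_ g) (g-fpf : FixedPointFree g) →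
    encodeMatching K f f-inv f-fpf ≡ encodeMatching K g g-inv g-fpf → f ≗ g
  encodeMatching-injective zero f g _ _ _ _ _ ()
  encodeMatching-injective (suc zero) f g _ f-fpf _ _ _ = ⊥-elim (f-fpf zero (fin1-unique _ _))
  encodeMatching-injective (suc (suc K)) f g f-inv f-fpf g-inv g-fpf eq
    with combine-injective (partnerOfZero f f-fpf) _ (partnerOfZero g g-fpf) _ eq
  ... | c≡c′ , eq′ = λ x → begin
    f x                                       ≡⟨ matchZeroTo-residual c f f-inv f0≡c x ⟩
    matchZeroTo c (residual f c) x            ≡⟨ matchZeroTo-cong c≡c′ (encodeMatching-injective K _ _ _ _ _ _ eq′) x ⟩
    matchZeroTo c′ (residual g c′) x          ≡⟨ matchZeroTo-residual c′ g g-inv g0≡c′ x ⟨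
    g x                                       ∎
    where
      open ≡-Reasoning
      c = partnerOfZero f f-fpf
      c′ = partnerOfZero g g-fpf
      f0≡c = sym (suc-predOfNonZero (f zero) (f-fpf zero))
      g0≡c′ = sym (suc-predOfNonZero (g zero) (g-fpf zero))

  remQuot-injective : {M : ℕ} (N : ℕ) {k k′ : Fin (M * N)} → remQuot {M} N k ≡ remQuot N k′ → k ≡ k′
  remQuot-injective {M} N {k} {k′} eq = trans (sym (combine-remQuot {M} N k)) (trans (cong (uncurry combine) eq) (combine-remQuot {M} N k′))

  extendMatching : {K : ℕ} → Fin (suc K) → FPFInvolution K → FPFInvolution (suc (suc K))
  extendMatching c (μ , μ-inv , μ-fpf) = matchZeroTo c μ , matchZeroTo-involutive c μ-inv , matchZeroTo-fixedPointFree c μ-fpf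

  decodeMatching : (K : ℕ) → Fin (matchingCount K) → FPFInvolution K
  decodeMatching zero _ = (λ x → x) , (λ _ → refl) , λ ()
  decodeMatching (suc (suc K)) k = extendMatching (proj₁ q) (decodeMatching K (proj₂ q))
    where q = remQuot {suc K} (matchingCount K) k

  decodeMatching-injective : (K : ℕ) {k k′ : Fin (matchingCount K)} →
    proj₁ (decodeMatching K k) ≗ proj₁ (decodeMatching K k′) → k ≡ k′
  decodeMatching-injective zero {zero} {zero} _ = refl
  decodeMatching-injective (suc (suc K)) eq with matchZeroTo-injective eq
  ... | c≡c′ , μ≗μ′ = remQuot-injective (matchingCount K) (×-≡,≡→≡ (c≡c′ , decodeMatching-injective K μ≗μ′))

  ↑ˡ≢↑ʳ : {M N : ℕ} (i : Fin M) (j : Fin N) → i ↑ˡ N ≢ M ↑ʳ j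
  ↑ˡ≢↑ʳ {M} {N} i j eq with () ← trans (sym (splitAt-↑ˡ M i N)) (trans (cong (splitAt M) eq) (splitAt-↑ʳ M N j))

  mutual
    encodeInvolution : (K : ℕ) (f : Endo K) → Involutive _≡_ f → Fin (involutionCount K)
    encodeInvolution zero f f-inv = zero
    encodeInvolution (suc K) f f-inv = encodeInvolutionBySplit K f f-inv (f zero ≟ zero)

    encodeInvolutionBySplit : (K : ℕ) (f : Endo (suc K)) → Involutive _≡_ f → Dec (f zero ≡ zero) →
      Fin (involutionCount (suc K))
    encodeInvolutionBySplit zero f f-inv _ = zero
    encodeInvolutionBySplit (suc K) f f-inv (yes f0≡0) =
      encodeInvolution (suc K) (dropZero f) (dropZero-involutive f f-inv f0≡0) ↑ˡ (suc K * involutionCount K)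
    encodeInvolutionBySplit (suc K) f f-inv (no f0≢0) =
      involutionCount (suc K) ↑ʳ combine c (encodeInvolution K (residual f c) (residual-involutive c f f-inv f0≡c))
      where
        c = predOfNonZero (f zero) f0≢0
        f0≡c = sym (suc-predOfNonZero (f zero) f0≢0)

  mutual
    encodeInvolution-injective : (K : ℕ) (f g : Endo K) (f-inv : Involutive _≡_ f) (g-inv : Involutive _≡_ g) →
      encodeInvolution K f f-inv ≡ encodeInvolution K g g-inv → f ≗ g
    encodeInvolution-injective zero f g _ _ _ ()
    encodeInvolution-injective (suc K) f g f-inv g-inv =
      encodeInvolutionBySplit-injective K f g f-inv g-inv (f zero ≟ zero) (g zero ≟ zero)

    encodeInvolutionBySplit-injective : (K : ℕ) (f g : Endo (suc K)) (f-inv : Involutive _≡_ f) (g-inv : Involutive _≡_ g)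
      (f0? : Dec (f zero ≡ zero)) (g0? : Dec (g zero ≡ zero)) →
      encodeInvolutionBySplit K f f-inv f0? ≡ encodeInvolutionBySplit K g g-inv g0? → f ≗ g
    encodeInvolutionBySplit-injective zero f g _ _ _ _ _ x = fin1-unique _ _
    encodeInvolutionBySplit-injective (suc K) f g f-inv g-inv (yes f0≡0) (yes g0≡0) eq x = begin
      f x                          ≡⟨ fixZero-dropZero f f-inv f0≡0 x ⟩
      fixZero (dropZero f) x
        ≡⟨ fixZero-cong (encodeInvolution-injective (suc K) _ _ (dropZero-involutive f f-inv f0≡0)
                          (dropZero-involutive g g-inv g0≡0) (↑ˡ-injective _ _ _ eq)) x ⟩
      fixZero (dropZero g) x       ≡⟨ fixZero-dropZero g g-inv g0≡0 x ⟨
      g x                          ∎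
      where open ≡-Reasoning
    encodeInvolutionBySplit-injective (suc K) f g f-inv g-inv (yes _) (no _) eq = ⊥-elim (↑ˡ≢↑ʳ _ _ eq)
    encodeInvolutionBySplit-injective (suc K) f g f-inv g-inv (no _) (yes _) eq = ⊥-elim (↑ˡ≢↑ʳ _ _ (sym eq))
    encodeInvolutionBySplit-injective (suc K) f g f-inv g-inv (no f0≢0) (no g0≢0) eq x
      with combine-injective (predOfNonZero (f zero) f0≢0) _ (predOfNonZero (g zero) g0≢0) _ (↑ʳ-injective _ _ _ eq)
    ... | c≡c′ , eq′ = begin
      f x                                       ≡⟨ matchZeroTo-residual c f f-inv f0≡c x ⟩
      matchZeroTo c (residual f c) x
        ≡⟨ matchZeroTo-cong c≡c′ (encodeInvolution-injective K _ _ (residual-involutive c f f-inv f0≡c)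
                                    (residual-involutive c′ g g-inv g0≡c′) eq′) x ⟩
      matchZeroTo c′ (residual g c′) x          ≡⟨ matchZeroTo-residual c′ g g-inv g0≡c′ x ⟨
      g x                                       ∎
      where
        open ≡-Reasoning
        c = predOfNonZero (f zero) f0≢0
        c′ = predOfNonZero (g zero) g0≢0
        f0≡c = sym (suc-predOfNonZero (f zero) f0≢0)
        g0≡c′ = sym (suc-predOfNonZero (g zero) g0≢0)

module Cyclic (k : ℕ) where

  open import Data.Nat using (ℕ; zero; suc; _+_; _∸_; _≤_; _<_; s≤s)
  open import Defs using (rot)
  open import Data.Bool using (Bool; true; false; not; _xor_)
  open import Data.Empty using (⊥; ⊥-elim)
  open import Relation.Nullary using (¬_)
  open import Data.Fin using (Fin; zero; suc; toℕ; fromℕ<; opposite)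
  open import Data.Fin.Properties using (toℕ-fromℕ<; toℕ-injective; toℕ<n; opposite-prop)
  open import Data.Nat.DivMod using (_%_; m%n<n; m%n%n≡m%n; %-distribˡ-+; n%n≡0; m<n⇒m%n≡m)
  open import Data.Nat.Properties using (+-comm; +-assoc; +-identityʳ; m∸n+n≡m; m+[n∸m]≡n; <⇒≤; m<n⇒n≢0; ∸-monoˡ-≤; m∸n≤m)
  open import Data.Nat.Tactic.RingSolver using (solve-∀)
  open import Data.Product using (_×_; _,_)
  open import Relation.Binary.Bundles using (Setoid)
  open import Relation.Binary.Structures using (IsEquivalence)
  open import Relation.Binary.PropositionalEquality using (_≡_; refl; sym; trans; cong; cong₂)
  import Relation.Binary.Reasoning.Setoid as SetoidReasoning

  m : ℕ
  m = suc k

  -- A record rather than x % m ≡ y % m, so that x and y can be inferred from the type.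
  infix 4 _≡ₘ_
  record _≡ₘ_ (x y : ℕ) : Set where
    constructor modEq
    field unModEq : x % m ≡ y % m

  ≡ₘ-isEquivalence : IsEquivalence _≡ₘ_
  ≡ₘ-isEquivalence = record
    { refl = modEq refl
    ; sym = λ (modEq e) → modEq (sym e)
    ; trans = λ (modEq e) (modEq e′) → modEq (trans e e′)
    }

  ≡ₘ-setoid : Setoid _ _
  ≡ₘ-setoid = record { isEquivalence = ≡ₘ-isEquivalence }

  open IsEquivalence ≡ₘ-isEquivalence public using () renaming (refl to ≡ₘ-refl; sym to ≡ₘ-sym; trans to ≡ₘ-trans)
  open SetoidReasoning ≡ₘ-setoid

  ≡⇒≡ₘ : ∀ {x y} → x ≡ y → x ≡ₘ y
  ≡⇒≡ₘ refl = ≡ₘ-refl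

  x%m≡ₘx : ∀ x → x % m ≡ₘ x
  x%m≡ₘx x = modEq (m%n%n≡m%n x m)

  m≡ₘ0 : m ≡ₘ 0
  m≡ₘ0 = modEq (n%n≡0 m)

  +-congₘ : ∀ {a b c d} → a ≡ₘ b → c ≡ₘ d → a + c ≡ₘ b + d
  +-congₘ {a} {b} {c} {d} (modEq e) (modEq e′) =
    modEq (trans (%-distribˡ-+ a c m) (trans (cong₂ (λ u v → (u + v) % m) e e′) (sym (%-distribˡ-+ b d m))))

  +-congˡₘ : ∀ a {c d} → c ≡ₘ d → a + c ≡ₘ a + d
  +-congˡₘ a = +-congₘ (≡ₘ-refl {a})

  +-congʳₘ : ∀ {a b} c → a ≡ₘ b → a + c ≡ₘ b + c
  +-congʳₘ c a≡b = +-congₘ a≡b (≡ₘ-refl {c})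

  negₘ : ℕ → ℕ
  negₘ c = m ∸ c % m

  +-negₘ : ∀ c → c + negₘ c ≡ₘ 0
  +-negₘ c = begin
    c + negₘ c       ≈⟨ +-congʳₘ (negₘ c) (≡ₘ-sym (x%m≡ₘx c)) ⟩
    c % m + negₘ c   ≡⟨ m+[n∸m]≡n (<⇒≤ (m%n<n c m)) ⟩
    m                ≈⟨ m≡ₘ0 ⟩
    0                ∎

  negₘ-+ : ∀ c → negₘ c + c ≡ₘ 0
  negₘ-+ c = ≡ₘ-trans (≡⇒≡ₘ (+-comm (negₘ c) c)) (+-negₘ c)

  +-cancelʳₘ : ∀ {a b} c → a + c ≡ₘ b + c → a ≡ₘ b
  +-cancelʳₘ {a} {b} c eq = begin
    a                  ≡⟨ +-identityʳ a ⟨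
    a + 0              ≈⟨ +-congˡₘ a (+-negₘ c) ⟨
    a + (c + negₘ c)   ≡⟨ +-assoc a c (negₘ c) ⟨
    a + c + negₘ c     ≈⟨ +-congʳₘ (negₘ c) eq ⟩
    b + c + negₘ c     ≡⟨ +-assoc b c (negₘ c) ⟩
    b + (c + negₘ c)   ≈⟨ +-congˡₘ b (+-negₘ c) ⟩
    b + 0              ≡⟨ +-identityʳ b ⟩
    b                  ∎

  +-cancelˡₘ : ∀ {a b} c → c + a ≡ₘ c + b → a ≡ₘ b
  +-cancelˡₘ {a} {b} c eq = +-cancelʳₘ c (≡ₘ-trans (≡⇒≡ₘ (+-comm a c)) (≡ₘ-trans eq (≡⇒≡ₘ (+-comm c b))))

  negₘ-negₘ : ∀ c → negₘ (negₘ c) ≡ₘ c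
  negₘ-negₘ c = +-cancelʳₘ (negₘ c) (≡ₘ-trans (negₘ-+ (negₘ c)) (≡ₘ-sym (+-negₘ c)))

  toℕ-injectiveₘ : {x y : Fin m} → toℕ x ≡ₘ toℕ y → x ≡ y
  toℕ-injectiveₘ {x} {y} (modEq e) = toℕ-injective (trans (sym (m<n⇒m%n≡m (toℕ<n x))) (trans e (m<n⇒m%n≡m (toℕ<n y))))

  toℕ-rot : ∀ p (x : Fin m) → toℕ (rot p x) ≡ (toℕ x + p) % m
  toℕ-rot p x = toℕ-fromℕ< (m%n<n (toℕ x + p) m)

  toℕ-rotₘ : ∀ p (x : Fin m) → toℕ (rot p x) ≡ₘ toℕ x + p
  toℕ-rotₘ p x = ≡ₘ-trans (≡⇒≡ₘ (toℕ-rot p x)) (x%m≡ₘx (toℕ x + p))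

  rot-congₘ : ∀ {p q} → p ≡ₘ q → (x : Fin m) → rot p x ≡ rot q x
  rot-congₘ {p} {q} p≡q x = toℕ-injectiveₘ (begin
    toℕ (rot p x)   ≈⟨ toℕ-rotₘ p x ⟩
    toℕ x + p       ≈⟨ +-congˡₘ (toℕ x) p≡q ⟩
    toℕ x + q       ≈⟨ toℕ-rotₘ q x ⟨
    toℕ (rot q x)   ∎)

  rot-zero : (x : Fin m) → rot 0 x ≡ x
  rot-zero x = toℕ-injectiveₘ (≡ₘ-trans (toℕ-rotₘ 0 x) (≡⇒≡ₘ (+-identityʳ (toℕ x))))

  rot-rot : ∀ p q (x : Fin m) → rot q (rot p x) ≡ rot (p + q) x
  rot-rot p q x = toℕ-injectiveₘ (begin
    toℕ (rot q (rot p x))   ≈⟨ toℕ-rotₘ q (rot p x) ⟩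
    toℕ (rot p x) + q       ≈⟨ +-congʳₘ q (toℕ-rotₘ p x) ⟩
    toℕ x + p + q           ≡⟨ +-assoc (toℕ x) p q ⟩
    toℕ x + (p + q)         ≈⟨ toℕ-rotₘ (p + q) x ⟨
    toℕ (rot (p + q) x)     ∎)

  rot-negₘ : ∀ p (x : Fin m) → rot p (rot (negₘ p) x) ≡ x
  rot-negₘ p x = trans (rot-rot (negₘ p) p x) (trans (rot-congₘ (negₘ-+ p) x) (rot-zero x))

  rot-negₘ′ : ∀ p (x : Fin m) → rot (negₘ p) (rot p x) ≡ x
  rot-negₘ′ p x = trans (rot-rot p (negₘ p) x) (trans (rot-congₘ (+-negₘ p) x) (rot-zero x))

  affine : Bool → ℕ → Fin m → Fin m
  affine false c x = rot c x
  affine true c x = rot c (opposite x)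

  reflectℕ : Bool → ℕ → ℕ
  reflectℕ false x = x
  reflectℕ true x = k ∸ x

  toℕ-affine : ∀ s c (x : Fin m) → toℕ (affine s c x) ≡ₘ reflectℕ s (toℕ x) + c
  toℕ-affine false c x = toℕ-rotₘ c x
  toℕ-affine true c x = ≡ₘ-trans (toℕ-rotₘ c (opposite x)) (≡⇒≡ₘ (cong (_+ c) (opposite-prop x)))

  affine-congₘ : ∀ s {c c′} → c ≡ₘ c′ → (x : Fin m) → affine s c x ≡ affine s c′ x
  affine-congₘ false c≡c′ x = rot-congₘ c≡c′ x
  affine-congₘ true c≡c′ x = rot-congₘ c≡c′ (opposite x)

  toℕ≤k : (x : Fin m) → toℕ x ≤ k
  toℕ≤k x with toℕ<n x
  ... | s≤s le = le

  reflectℕ-not-+ : ∀ s (x : Fin m) → reflectℕ (not s) (toℕ x) + reflectℕ s (toℕ x) ≡ k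
  reflectℕ-not-+ false x = m∸n+n≡m (toℕ≤k x)
  reflectℕ-not-+ true x = m+[n∸m]≡n (toℕ≤k x)

  composeShift : Bool → ℕ → ℕ → ℕ
  composeShift false c c′ = c + c′
  composeShift true c c′ = c′ + negₘ c

  affine-affine : ∀ s c s′ c′ (x : Fin m) → affine s′ c′ (affine s c x) ≡ affine (s′ xor s) (composeShift s′ c c′) x
  affine-affine s c false c′ x = toℕ-injectiveₘ (begin
    toℕ (affine false c′ (affine s c x))   ≈⟨ toℕ-affine false c′ (affine s c x) ⟩
    toℕ (affine s c x) + c′                ≈⟨ +-congʳₘ c′ (toℕ-affine s c x) ⟩
    reflectℕ s (toℕ x) + c + c′            ≡⟨ +-assoc (reflectℕ s (toℕ x)) c c′ ⟩
    reflectℕ s (toℕ x) + (c + c′)          ≈⟨ toℕ-affine s (c + c′) x ⟨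
    toℕ (affine s (c + c′) x)              ∎)
  affine-affine s c true c′ x = toℕ-injectiveₘ (begin
    toℕ (affine true c′ y)                  ≈⟨ toℕ-affine true c′ y ⟩
    k ∸ toℕ y + c′                          ≈⟨ +-cancelʳₘ (toℕ y) shifted ⟩
    R′ + (c′ + negₘ c)                      ≈⟨ toℕ-affine (not s) (c′ + negₘ c) x ⟨
    toℕ (affine (not s) (c′ + negₘ c) x)    ∎)
    where
      y = affine s c x
      R = reflectℕ s (toℕ x)
      R′ = reflectℕ (not s) (toℕ x)
      swap-last : ∀ a b d → a + b + d ≡ a + d + b
      swap-last = solve-∀
      regroup : ∀ a b u v w → a + b + u + (v + w) ≡ a + (u + w) + (b + v)
      regroup = solve-∀
      shifted : k ∸ toℕ y + c′ + toℕ y ≡ₘ R′ + (c′ + negₘ c) + toℕ y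
      shifted = begin
        k ∸ toℕ y + c′ + toℕ y              ≡⟨ swap-last (k ∸ toℕ y) c′ (toℕ y) ⟩
        k ∸ toℕ y + toℕ y + c′              ≡⟨ cong (_+ c′) (m∸n+n≡m (toℕ≤k y)) ⟩
        k + c′                              ≡⟨ cong (_+ c′) (reflectℕ-not-+ s x) ⟨
        R′ + R + c′                         ≡⟨ +-identityʳ _ ⟨
        R′ + R + c′ + 0                     ≈⟨ +-congˡₘ (R′ + R + c′) (+-negₘ c) ⟨
        R′ + R + c′ + (c + negₘ c)          ≡⟨ regroup R′ R c′ c (negₘ c) ⟩
        R′ + (c′ + negₘ c) + (R + c)        ≈⟨ +-congˡₘ (R′ + (c′ + negₘ c)) (toℕ-affine s c x) ⟨
        R′ + (c′ + negₘ c) + toℕ y          ∎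

  module _ (2≤k : 2 ≤ k) where

    private
      1<m : 1 < m
      1<m = s≤s (<⇒≤ 2≤k)

      k∸1≢ₘ0 : ¬ (0 ≡ₘ k ∸ 1)
      k∸1≢ₘ0 (modEq e) = m<n⇒n≢0 (∸-monoˡ-≤ 1 2≤k) (sym (trans e (m<n⇒m%n≡m (s≤s (m∸n≤m k 1)))))

      rotation≢reflection : ∀ c c′ → c ≡ₘ k + c′ → 1 + c ≡ₘ k ∸ 1 + c′ → ⊥
      rotation≢reflection c c′ e0 e1 = k∸1≢ₘ0 (+-cancelʳₘ c′ (begin
        c′              ≈⟨ +-congʳₘ c′ m≡ₘ0 ⟨
        1 + (k + c′)    ≈⟨ +-congˡₘ 1 e0 ⟨
        1 + c           ≈⟨ e1 ⟩
        k ∸ 1 + c′      ∎))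

    affine-faithful : ∀ s c s′ c′ → (∀ x → affine s c x ≡ affine s′ c′ x) → s ≡ s′ × c ≡ₘ c′
    affine-faithful s c s′ c′ eq = decide s s′ (valueAt zero refl) (valueAt (fromℕ< 1<m) (toℕ-fromℕ< 1<m))
      where
        valueAt : ∀ x {i} → toℕ x ≡ i → reflectℕ s i + c ≡ₘ reflectℕ s′ i + c′
        valueAt x refl = ≡ₘ-trans (≡ₘ-sym (toℕ-affine s c x)) (≡ₘ-trans (≡⇒≡ₘ (cong toℕ (eq x))) (toℕ-affine s′ c′ x))
        decide : ∀ s s′ → reflectℕ s 0 + c ≡ₘ reflectℕ s′ 0 + c′ → reflectℕ s 1 + c ≡ₘ reflectℕ s′ 1 + c′ → s ≡ s′ × c ≡ₘ c′
        decide false false e0 e1 = refl , e0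
        decide true true e0 e1 = refl , +-cancelˡₘ k e0
        decide false true e0 e1 = ⊥-elim (rotation≢reflection c c′ e0 e1)
        decide true false e0 e1 = ⊥-elim (rotation≢reflection c′ c (≡ₘ-sym e0) (≡ₘ-sym e1))

open Involutions using (Endo; Commute)

module Commuting {M : ℕ} (σ : Endo M) (σ-involutive : Involutive _≡_ σ) {b : ℕ} (b≤M : b ≤ M)
  (covers : ∀ x → toℕ x < b ⊎ toℕ (σ x) < b)
  (fixes : ∀ x → toℕ x < b → toℕ (σ x) < b → σ x ≡ x) where

  open import Algebra.Definitions using (Involutive)
  open import Data.Fin using (Fin; toℕ; zero; suc; combine; funToFin; finToFun; fromℕ<; inject≤)
  open import Data.Nat using (ℕ; _≤_; _<_; _*_; _^_)
  open import Data.Sum using (_⊎_; inj₁; inj₂)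
  open import Relation.Binary.PropositionalEquality using (_≡_; _≗_; refl; sym; trans; cong; subst; module ≡-Reasoning)
  open Involutions using (Endo; Commute; involutionCount; encodeInvolution; encodeInvolution-injective)
  open import Data.Empty using (⊥-elim)
  open import Data.Fin.Properties using (_≟_; combine-injective; finToFun-funToFin; toℕ-fromℕ<; toℕ-inject≤; toℕ-injective; toℕ<n)
  open import Data.Product using (_×_; _,_; proj₁; proj₂)
  open import Relation.Nullary using (yes; no)

  -- Every σ-orbit meets [0, b) in exactly one point, so an involution μ commuting with σ is
  -- determined by the involution it induces on [0, b) and, for each y < b, by whether μ y is
  -- itself in [0, b) or the σ-image of such a point.
  section : Fin b → Fin M
  section y = inject≤ y b≤M

  orbitOf : Fin M → Fin b
  orbitOf x with covers x
  ... | inj₁ x<b = fromℕ< x<b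
  ... | inj₂ σx<b = fromℕ< σx<b

  orbitOf-section : ∀ y → orbitOf (section y) ≡ y
  orbitOf-section y with covers (section y)
  ... | inj₁ x<b = toℕ-injective (trans (toℕ-fromℕ< x<b) (toℕ-inject≤ y b≤M))
  ... | inj₂ σx<b = toℕ-injective (trans (toℕ-fromℕ< σx<b) (trans (cong toℕ (fixes (section y) x<b σx<b)) (toℕ-inject≤ y b≤M)))
    where x<b = subst (_< b) (sym (toℕ-inject≤ y b≤M)) (toℕ<n y)

  section-orbitOf : ∀ x → section (orbitOf x) ≡ x ⊎ section (orbitOf x) ≡ σ x
  section-orbitOf x with covers x
  ... | inj₁ x<b = inj₁ (toℕ-injective (trans (toℕ-inject≤ _ b≤M) (toℕ-fromℕ< x<b)))
  ... | inj₂ σx<b = inj₂ (toℕ-injective (trans (toℕ-inject≤ _ b≤M) (toℕ-fromℕ< σx<b)))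

  orbitOf-σ : ∀ x → orbitOf (σ x) ≡ orbitOf x
  orbitOf-σ x with covers (σ x) | covers x
  ... | inj₁ σx<b | inj₁ x<b = toℕ-injective (trans (toℕ-fromℕ< σx<b) (trans (cong toℕ (fixes x x<b σx<b)) (sym (toℕ-fromℕ< x<b))))
  ... | inj₁ σx<b | inj₂ σx<b′ = toℕ-injective (trans (toℕ-fromℕ< σx<b) (sym (toℕ-fromℕ< σx<b′)))
  ... | inj₂ σσx<b | inj₁ x<b = toℕ-injective (trans (toℕ-fromℕ< σσx<b) (trans (cong toℕ (σ-involutive x)) (sym (toℕ-fromℕ< x<b))))
  ... | inj₂ σσx<b | inj₂ σx<b = toℕ-injective (trans (toℕ-fromℕ< σσx<b) (trans (cong toℕ (trans (σ-involutive x) (sym σx≡x))) (sym (toℕ-fromℕ< σx<b))))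
    where σx≡x = fixes x (subst (λ z → toℕ z < b) (σ-involutive x) σσx<b) σx<b

  quotientMap : Endo M → Endo b
  quotientMap μ y = orbitOf (μ (section y))

  quotientMap-involutive : ∀ μ → Involutive _≡_ μ → Commute μ σ → Involutive _≡_ (quotientMap μ)
  quotientMap-involutive μ μ-inv μσ≡σμ y with section-orbitOf (μ (section y))
  ... | inj₁ eq = trans (cong (λ z → orbitOf (μ z)) eq) (trans (cong orbitOf (μ-inv (section y))) (orbitOf-section y))
  ... | inj₂ eq = begin
    orbitOf (μ (section (orbitOf (μ (section y)))))   ≡⟨ cong (λ z → orbitOf (μ z)) eq ⟩
    orbitOf (μ (σ (μ (section y))))                   ≡⟨ cong orbitOf (μσ≡σμ (μ (section y))) ⟩
    orbitOf (σ (μ (μ (section y))))                   ≡⟨ orbitOf-σ _ ⟩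
    orbitOf (μ (μ (section y)))                       ≡⟨ cong orbitOf (μ-inv (section y)) ⟩
    orbitOf (section y)                               ≡⟨ orbitOf-section y ⟩
    y                                                 ∎
    where open ≡-Reasoning

  flipped : Endo M → Fin b → Fin 2
  flipped μ y with μ (section y) ≟ section (quotientMap μ y)
  ... | yes _ = zero
  ... | no _ = suc zero

  code : ∀ μ → Involutive _≡_ μ → Commute μ σ → Fin (2 ^ b * involutionCount b)
  code μ μ-inv μσ≡σμ = combine (funToFin (flipped μ)) (encodeInvolution b (quotientMap μ) (quotientMap-involutive μ μ-inv μσ≡σμ))

  private
    onSection : ∀ μ y →
      (flipped μ y ≡ zero × μ (section y) ≡ section (quotientMap μ y)) ⊎
      (flipped μ y ≡ suc zero × μ (section y) ≡ σ (section (quotientMap μ y)))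
    onSection μ y with μ (section y) ≟ section (quotientMap μ y)
    ... | yes eq = inj₁ (refl , eq)
    ... | no neq with section-orbitOf (μ (section y))
    ...   | inj₁ eq = ⊥-elim (neq (sym eq))
    ...   | inj₂ eq = inj₂ (refl , trans (sym (σ-involutive (μ (section y)))) (cong σ (sym eq)))

    agreeOnSection : ∀ μ μ′ → flipped μ ≗ flipped μ′ → quotientMap μ ≗ quotientMap μ′ → ∀ y → μ (section y) ≡ μ′ (section y)
    agreeOnSection μ μ′ same-flips same-quotient y with onSection μ y | onSection μ′ y
    ... | inj₁ (_ , eq) | inj₁ (_ , eq′) = trans eq (trans (cong section (same-quotient y)) (sym eq′))
    ... | inj₂ (_ , eq) | inj₂ (_ , eq′) = trans eq (trans (cong (λ z → σ (section z)) (same-quotient y)) (sym eq′))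
    ... | inj₁ (b , _) | inj₂ (b′ , _) with () ← trans (sym b) (trans (same-flips y) b′)
    ... | inj₂ (b , _) | inj₁ (b′ , _) with () ← trans (sym b′) (trans (sym (same-flips y)) b)

  code-injective : ∀ μ μ′ μ-inv μσ≡σμ μ′-inv μ′σ≡σμ′ → code μ μ-inv μσ≡σμ ≡ code μ′ μ′-inv μ′σ≡σμ′ → μ ≗ μ′
  code-injective μ μ′ μ-inv μσ≡σμ μ′-inv μ′σ≡σμ′ eq x = fromSection (section-orbitOf x)
    where
      same-parts = combine-injective _ _ _ _ eq
      same-flips : flipped μ ≗ flipped μ′
      same-flips y = trans (sym (finToFun-funToFin (flipped μ) y))
        (trans (cong (λ t → finToFun t y) (proj₁ same-parts)) (finToFun-funToFin (flipped μ′) y))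
      same-quotient : quotientMap μ ≗ quotientMap μ′
      same-quotient = encodeInvolution-injective b _ _ (quotientMap-involutive μ μ-inv μσ≡σμ)
        (quotientMap-involutive μ′ μ′-inv μ′σ≡σμ′) (proj₂ same-parts)
      agree : ∀ y → μ (section y) ≡ μ′ (section y)
      agree = agreeOnSection μ μ′ same-flips same-quotient
      fromSection : section (orbitOf x) ≡ x ⊎ section (orbitOf x) ≡ σ x → μ x ≡ μ′ x
      fromSection (inj₁ s≡x) = trans (cong μ (sym s≡x)) (trans (agree (orbitOf x)) (cong μ′ s≡x))
      fromSection (inj₂ s≡σx) = begin
        μ x                          ≡⟨ cong μ σs≡x ⟨
        μ (σ (section (orbitOf x)))  ≡⟨ μσ≡σμ _ ⟩
        σ (μ (section (orbitOf x)))  ≡⟨ cong σ (agree (orbitOf x)) ⟩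
        σ (μ′ (section (orbitOf x))) ≡⟨ μ′σ≡σμ′ _ ⟨
        μ′ (σ (section (orbitOf x))) ≡⟨ cong μ′ σs≡x ⟩
        μ′ x                         ∎
        where
          open ≡-Reasoning
          σs≡x = trans (cong σ s≡σx) (σ-involutive x)

module DihedralAction (n′ : ℕ) where

  open import Data.Nat using (ℕ; suc; _+_; _≤_; z≤n; s≤s)
  open import Defs using (Dihedral; act; rot)
  open import Data.Bool using (Bool; true; false; _xor_)
  open import Data.Fin using (Fin; toℕ; fromℕ<)
  open import Data.Fin.Properties using (toℕ-fromℕ<)
  open import Data.Nat.DivMod using (m%n<n)
  open import Data.Nat.Properties using (+-mono-≤)
  open import Data.Product using (_,_; proj₁; proj₂)
  open import Data.Product.Properties using (×-≡,≡→≡)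
  open import Relation.Binary.PropositionalEquality using (_≡_; _≗_; refl; sym; trans; cong; module ≡-Reasoning)

  n : ℕ
  n = suc n′

  -- suc k is definitionally 2 * n, so that Fin m is V n.
  k : ℕ
  k = n′ + (suc n′ + 0)

  open Cyclic k public

  ⟦_⟧ : Dihedral n → Fin m → Fin m
  ⟦ g ⟧ = act {n} g

  act-affine : ∀ g → ⟦ g ⟧ ≗ affine (proj₂ g) (toℕ (proj₁ g))
  act-affine (a , false) x = refl
  act-affine (a , true) x = refl

  element : Bool → ℕ → Dihedral n
  element s c = fromℕ< (m%n<n c m) , s

  act-element : ∀ s c → ⟦ element s c ⟧ ≗ affine s c
  act-element false c = affine-congₘ false (≡ₘ-trans (≡⇒≡ₘ (toℕ-fromℕ< (m%n<n c m))) (x%m≡ₘx c))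
  act-element true c = affine-congₘ true (≡ₘ-trans (≡⇒≡ₘ (toℕ-fromℕ< (m%n<n c m))) (x%m≡ₘx c))

  identity : Dihedral n
  identity = element false 0

  act-identity : ⟦ identity ⟧ ≗ (λ x → x)
  act-identity x = trans (act-element false 0 x) (rot-zero x)

  infixl 7 _∙_
  infix 8 _⁻¹

  _∙_ : Dihedral n → Dihedral n → Dihedral n
  (a′ , s′) ∙ (a , s) = element (s′ xor s) (composeShift s′ (toℕ a) (toℕ a′))

  act-∙ : ∀ g h x → ⟦ g ∙ h ⟧ x ≡ ⟦ g ⟧ (⟦ h ⟧ x)
  act-∙ g@(a′ , s′) h@(a , s) x = begin
    ⟦ g ∙ h ⟧ x                                              ≡⟨ act-element (s′ xor s) _ x ⟩
    affine (s′ xor s) (composeShift s′ (toℕ a) (toℕ a′)) x   ≡⟨ affine-affine s (toℕ a) s′ (toℕ a′) x ⟨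
    affine s′ (toℕ a′) (affine s (toℕ a) x)                  ≡⟨ act-affine g _ ⟨
    ⟦ g ⟧ (affine s (toℕ a) x)                               ≡⟨ cong ⟦ g ⟧ (act-affine h x) ⟨
    ⟦ g ⟧ (⟦ h ⟧ x)                                          ∎
    where open ≡-Reasoning

  _⁻¹ : Dihedral n → Dihedral n
  (a , false) ⁻¹ = element false (negₘ (toℕ a))
  (a , true) ⁻¹ = a , true

  act-⁻¹ : ∀ g x → ⟦ g ⁻¹ ⟧ (⟦ g ⟧ x) ≡ x
  act-⁻¹ (a , false) x = trans (act-element false (negₘ (toℕ a)) (rot (toℕ a) x)) (rot-negₘ′ (toℕ a) x)
  act-⁻¹ (a , true) x = trans (affine-affine true (toℕ a) true (toℕ a) x) (trans (affine-congₘ false (+-negₘ (toℕ a)) x) (rot-zero x))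

  act-⁻¹′ : ∀ g x → ⟦ g ⟧ (⟦ g ⁻¹ ⟧ x) ≡ x
  act-⁻¹′ (a , false) x = trans (cong (rot (toℕ a)) (act-element false (negₘ (toℕ a)) x)) (rot-negₘ (toℕ a) x)
  act-⁻¹′ (a , true) x = act-⁻¹ (a , true) x

  act-injective : ∀ g {x y} → ⟦ g ⟧ x ≡ ⟦ g ⟧ y → x ≡ y
  act-injective g {x} {y} eq = trans (sym (act-⁻¹ g x)) (trans (cong ⟦ g ⁻¹ ⟧ eq) (act-⁻¹ g y))

  act-faithful : 1 ≤ n′ → ∀ {g h} → ⟦ g ⟧ ≗ ⟦ h ⟧ → g ≡ h
  act-faithful 1≤n′ {g@(a , s)} {h@(a′ , s′)} eq
    with affine-faithful (+-mono-≤ 1≤n′ (s≤s z≤n)) s (toℕ a) s′ (toℕ a′)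
           (λ x → trans (sym (act-affine g x)) (trans (eq x) (act-affine h x)))
  ... | s≡s′ , a≡a′ = ×-≡,≡→≡ (toℕ-injectiveₘ a≡a′ , s≡s′)

module Stabilisers (n′ : ℕ) where

  open import Data.Nat using (ℕ; zero; suc; _+_; _*_; _∸_; _^_; _≤_; _<_; z≤n; s≤s; z<s)
  open import Defs using (Dihedral; rot)
  open import Algebra.Definitions using (Involutive)
  open import Data.Bool using (true; false)
  open import Data.Empty using (⊥-elim)
  open import Data.Fin using (Fin; zero; suc; toℕ; fromℕ<; opposite; inject≤; funToFin; finToFun; _↑ˡ_; _↑ʳ_; combine; remQuot; splitAt)
  open import Data.Fin.Properties using (toℕ-fromℕ<; toℕ-injective; toℕ<n; toℕ-inject≤; opposite-prop; opposite-involutive; finToFun-funToFin; splitAt-↑ˡ; splitAt-↑ʳ; remQuot-combine)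
  open import Data.Nat.DivMod using (_%_; _/_; m%n<n; m*n/n≡m; /-monoˡ-≤; m<n⇒m%n≡m; [m+n]%n≡m%n; n%n≡0; m/n*n≤m; m≡m%n+[m/n]*n)
  open import Data.Nat.Induction using (<-rec)
  open import Data.Nat.Properties
  open import Data.Nat.Tactic.RingSolver using (solve-∀)
  open import Data.Product using (Σ; _×_; _,_; proj₁; proj₂; uncurry)
  open import Data.Sum using (_⊎_; inj₁; inj₂; [_,_]′)
  open import Function using (_∘_)
  open import Relation.Binary.PropositionalEquality using (_≡_; _≗_; refl; sym; trans; cong; subst; module ≡-Reasoning)
  open import Relation.Nullary using (¬_; yes; no)
  import Relation.Binary.Reasoning.Setoid as SetoidReasoning
  open Involutions using (Endo; Commute; commute-sym; commute-respʳ-≗; involutionCount; module Conjugation)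
  open DihedralAction n′

  m≡n+n : m ≡ n + n
  m≡n+n = cong (λ j → suc (n′ + j)) (+-identityʳ (suc n′))

  k≡n′+n : k ≡ n′ + n
  k≡n′+n = cong (n′ +_) (+-identityʳ (suc n′))

  n<m : n < m
  n<m = subst (n <_) (sym m≡n+n) (m<m+n n z<s)

  toℕ<n+n : (x : Fin m) → toℕ x < n + n
  toℕ<n+n x = subst (toℕ x <_) m≡n+n (toℕ<n x)

  -- Besides rotations, the symmetries below are the half turn and, up to conjugation by a
  -- rotation, the reflections opposite : x ↦ −1 − x (no fixed vertex) and negation : x ↦ −x
  -- (fixing 0 and n).
  halfTurn : Endo m
  halfTurn = rot n

  halfTurn-involutive : Involutive _≡_ halfTurn
  halfTurn-involutive x = trans (rot-rot n n x) (trans (rot-congₘ (≡ₘ-trans (≡⇒≡ₘ (sym m≡n+n)) m≡ₘ0) x) (rot-zero x))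

  toℕ-halfTurn-low : (x : Fin m) → toℕ x < n → toℕ (halfTurn x) ≡ toℕ x + n
  toℕ-halfTurn-low x x<n = trans (toℕ-rot n x) (m<n⇒m%n≡m (subst (toℕ x + n <_) (sym m≡n+n) (+-monoˡ-< n x<n)))

  toℕ-halfTurn-high : (x : Fin m) → n ≤ toℕ x → toℕ (halfTurn x) ≡ toℕ x ∸ n
  toℕ-halfTurn-high x n≤x = begin
    toℕ (halfTurn x)         ≡⟨ toℕ-rot n x ⟩
    (toℕ x + n) % m          ≡⟨ cong (_% m) x+n≡ ⟩
    (toℕ x ∸ n + m) % m      ≡⟨ [m+n]%n≡m%n (toℕ x ∸ n) m ⟩
    (toℕ x ∸ n) % m          ≡⟨ m<n⇒m%n≡m (≤-<-trans (m∸n≤m (toℕ x) n) (toℕ<n x)) ⟩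
    toℕ x ∸ n                ∎
    where
      open ≡-Reasoning
      x+n≡ : toℕ x + n ≡ toℕ x ∸ n + m
      x+n≡ = begin
        toℕ x + n            ≡⟨ cong (_+ n) (m∸n+n≡m n≤x) ⟨
        toℕ x ∸ n + n + n    ≡⟨ +-assoc (toℕ x ∸ n) n n ⟩
        toℕ x ∸ n + (n + n)  ≡⟨ cong (toℕ x ∸ n +_) m≡n+n ⟨
        toℕ x ∸ n + m        ∎

  halfTurn-covers : ∀ x → toℕ x < n ⊎ toℕ (halfTurn x) < n
  halfTurn-covers x with toℕ x <? n
  ... | yes x<n = inj₁ x<n
  ... | no x≮n = inj₂ (subst (_< n) (sym (toℕ-halfTurn-high x (≮⇒≥ x≮n))) (m<n+o⇒m∸n<o (toℕ x) n (toℕ<n+n x)))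

  halfTurn-fixes : ∀ x → toℕ x < n → toℕ (halfTurn x) < n → halfTurn x ≡ x
  halfTurn-fixes x x<n σx<n = ⊥-elim (<⇒≱ σx<n (subst (n ≤_) (sym (toℕ-halfTurn-low x x<n)) (m≤n+m n (toℕ x))))

  k∸n≡n′ : k ∸ n ≡ n′
  k∸n≡n′ = trans (cong (_∸ n) k≡n′+n) (m+n∸n≡m n′ n)

  k∸x<n : ∀ {x} → n ≤ x → k ∸ x < n
  k∸x<n {x} n≤x = s≤s (subst (k ∸ x ≤_) k∸n≡n′ (∸-monoʳ-≤ k n≤x))

  k≤x+j : ∀ {x j} → k ∸ x ≤ j → n′ + n ≤ x + j
  k≤x+j {x} {j} k∸x≤j = subst (_≤ x + j) k≡n′+n (≤-trans (m≤n+m∸n k x) (+-monoʳ-≤ x k∸x≤j))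

  opposite-covers : ∀ (x : Fin m) → toℕ x < n ⊎ toℕ (opposite x) < n
  opposite-covers x with toℕ x <? n
  ... | yes x<n = inj₁ x<n
  ... | no x≮n = inj₂ (subst (_< n) (sym (opposite-prop x)) (k∸x<n (≮⇒≥ x≮n)))

  opposite-fixes : ∀ (x : Fin m) → toℕ x < n → toℕ (opposite x) < n → opposite x ≡ x
  opposite-fixes x x<n σx<n = ⊥-elim (<⇒≱ x<n (+-cancelˡ-≤ n′ n (toℕ x) (subst (n′ + n ≤_) (+-comm (toℕ x) n′) (k≤x+j k∸x≤n′))))
    where k∸x≤n′ = ≤-pred (subst (_< n) (opposite-prop x) σx<n)

  negation : Endo m
  negation = affine true 1

  negation-involutive : Involutive _≡_ negation
  negation-involutive x = trans (affine-affine true 1 true 1 x) (trans (affine-congₘ false (+-negₘ 1) x) (rot-zero x))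

  negℕ : ℕ → ℕ
  negℕ zero = 0
  negℕ (suc y) = k ∸ y

  toℕ-negation : (x : Fin m) → toℕ (negation x) ≡ negℕ (toℕ x)
  toℕ-negation x = trans (toℕ-rot 1 (opposite x)) (trans (cong (λ z → (z + 1) % m) (opposite-prop x)) (reduce x))
    where
      reduce : (x : Fin m) → (k ∸ toℕ x + 1) % m ≡ negℕ (toℕ x)
      reduce zero = trans (cong (_% m) (+-comm k 1)) (n%n≡0 m)
      reduce (suc y) = begin
        (k ∸ suc (toℕ y) + 1) % m    ≡⟨ cong (_% m) (+-comm _ 1) ⟩
        (1 + (k ∸ suc (toℕ y))) % m  ≡⟨ cong (_% m) (+-∸-assoc 1 (toℕ<n y)) ⟨
        (k ∸ toℕ y) % m              ≡⟨ m<n⇒m%n≡m (s≤s (m∸n≤m k (toℕ y))) ⟩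
        k ∸ toℕ y                    ∎
        where open ≡-Reasoning

  negation-covers : ∀ (x : Fin m) → toℕ x < suc n ⊎ toℕ (negation x) < suc n
  negation-covers x with toℕ x <? suc n
  ... | yes x≤n = inj₁ x≤n
  ... | no x≰n = inj₂ (subst (_< suc n) (sym (toℕ-negation x)) (beyond x (≮⇒≥ x≰n)))
    where
      beyond : (x : Fin m) → suc n ≤ toℕ x → negℕ (toℕ x) < suc n
      beyond (suc y) (s≤s n≤y) = m<n⇒m<1+n (k∸x<n n≤y)

  negation-fixes : ∀ (x : Fin m) → toℕ x < suc n → toℕ (negation x) < suc n → negation x ≡ x
  negation-fixes zero _ _ = toℕ-injective (toℕ-negation zero)
  negation-fixes (suc y) (s≤s y<n) σx≤n = toℕ-injective (trans (toℕ-negation (suc y)) (begin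
    k ∸ toℕ y   ≡⟨ cong (k ∸_) y≡n′ ⟩
    k ∸ n′      ≡⟨ cong (_∸ n′) k≡n′+n ⟩
    n′ + n ∸ n′ ≡⟨ m+n∸m≡n n′ n ⟩
    n           ≡⟨ cong suc y≡n′ ⟨
    suc (toℕ y) ∎))
    where
      open ≡-Reasoning
      y≡n′ : toℕ y ≡ n′
      y≡n′ = ≤-antisym (≤-pred y<n) (+-cancelʳ-≤ n n′ (toℕ y) (k≤x+j (≤-pred (subst (_< suc n) (toℕ-negation (suc y)) σx≤n))))

  module _ (μ : Endo m) where

    commute-rot-+ : ∀ p q → Commute μ (rot p) → Commute μ (rot q) → Commute μ (rot (p + q))
    commute-rot-+ p q μp≡pμ μq≡qμ x = begin
      μ (rot (p + q) x)      ≡⟨ cong μ (rot-rot p q x) ⟨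
      μ (rot q (rot p x))    ≡⟨ μq≡qμ (rot p x) ⟩
      rot q (μ (rot p x))    ≡⟨ cong (rot q) (μp≡pμ x) ⟩
      rot q (rot p (μ x))    ≡⟨ rot-rot p q (μ x) ⟩
      rot (p + q) (μ x)      ∎
      where open ≡-Reasoning

    commute-rot-congₘ : ∀ {p q} → p ≡ₘ q → Commute μ (rot p) → Commute μ (rot q)
    commute-rot-congₘ p≡q μp≡pμ x = trans (cong μ (sym (rot-congₘ p≡q x))) (trans (μp≡pμ x) (rot-congₘ p≡q (μ x)))

    commute-rot-negₘ : ∀ p → Commute μ (rot p) → Commute μ (rot (negₘ p))
    commute-rot-negₘ p μp≡pμ x = begin
      μ (rot (negₘ p) x)                            ≡⟨ rot-negₘ′ p _ ⟨
      rot (negₘ p) (rot p (μ (rot (negₘ p) x)))     ≡⟨ cong (rot (negₘ p)) (μp≡pμ _) ⟨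
      rot (negₘ p) (μ (rot p (rot (negₘ p) x)))     ≡⟨ cong (λ y → rot (negₘ p) (μ y)) (rot-negₘ p x) ⟩
      rot (negₘ p) (μ x)                            ∎
      where open ≡-Reasoning

    commute-rot-m∸ : ∀ {p} → p < m → Commute μ (rot p) → Commute μ (rot (m ∸ p))
    commute-rot-m∸ {p} p<m μp≡pμ = commute-rot-congₘ (≡⇒≡ₘ (cong (m ∸_) (m<n⇒m%n≡m p<m))) (commute-rot-negₘ p μp≡pμ)

  ShortRotationSymmetric : Endo m → Set
  ShortRotationSymmetric μ = Σ ℕ λ p → 1 ≤ p × p * 3 ≤ m × Commute μ (rot p)

  private
    excess-rotation : ∀ a → a + a < m → m < a * 3 → (m ∸ (a + a)) * 3 < m
    excess-rotation a 2a<m m<3a = +-cancelʳ-< (m + m) _ m (begin-strict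
      (m ∸ (a + a)) * 3 + (m + m)     <⟨ +-monoʳ-< ((m ∸ (a + a)) * 3) (+-mono-< m<3a m<3a) ⟩
      (m ∸ (a + a)) * 3 + (a * 3 + a * 3) ≡⟨ cong ((m ∸ (a + a)) * 3 +_) (*-distribʳ-+ 3 a a) ⟨
      (m ∸ (a + a)) * 3 + (a + a) * 3 ≡⟨ *-distribʳ-+ 3 (m ∸ (a + a)) (a + a) ⟨
      (m ∸ (a + a) + (a + a)) * 3     ≡⟨ cong (_* 3) (m∸n+n≡m (<⇒≤ 2a<m)) ⟩
      m * 3                           ≡⟨ triple m ⟩
      m + (m + m)                     ∎)
      where
        open ≤-Reasoning
        triple : ∀ x → x * 3 ≡ x + (x + x)
        triple = solve-∀

  -- For m/3 < a < n the double 2a is a rotation through m − 2a < m/3 in the other direction.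
  halfTurnOrShort : ∀ μ a → 1 ≤ a → a ≤ n → Commute μ (rot a) → Commute μ halfTurn ⊎ ShortRotationSymmetric μ
  halfTurnOrShort μ a 1≤a a≤n μa≡aμ with m≤n⇒m<n∨m≡n a≤n
  ... | inj₂ refl = inj₁ μa≡aμ
  ... | inj₁ a<n with a * 3 ≤? m
  ...   | yes 3a≤m = inj₂ (a , 1≤a , 3a≤m , μa≡aμ)
  ...   | no 3a≰m = inj₂ (m ∸ (a + a) , m+n≤o⇒m≤o∸n 1 2a<m , <⇒≤ (excess-rotation a 2a<m (≰⇒> 3a≰m)) ,
                         commute-rot-m∸ μ 2a<m (commute-rot-+ μ a a μa≡aμ μa≡aμ))
    where 2a<m = subst (a + a <_) (sym m≡n+n) (+-mono-< a<n a<n)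

  rotationSymmetry : ∀ μ {a} → 1 ≤ a → a < m → Commute μ (rot a) → Commute μ halfTurn ⊎ ShortRotationSymmetric μ
  rotationSymmetry μ {a} 1≤a a<m μa≡aμ with a ≤? n
  ... | yes a≤n = halfTurnOrShort μ a 1≤a a≤n μa≡aμ
  ... | no a≰n = halfTurnOrShort μ (m ∸ a) (m+n≤o⇒m≤o∸n 1 a<m) (<⇒≤ m∸a<n) (commute-rot-m∸ μ a<m μa≡aμ)
    where m∸a<n = subst (m ∸ a <_) (trans (cong (_∸ n) m≡n+n) (m+n∸n≡m n n)) (∸-monoʳ-< (≰⇒> a≰n) (<⇒≤ a<m))

  L : ℕ
  L = m / 3

  3L≤m : L * 3 ≤ m
  3L≤m = m/n*n≤m m 3

  L≤m : L ≤ m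
  L≤m = ≤-trans (m≤m*n L 3) 3L≤m

  initialSegment : Endo m → Fin (m ^ L)
  initialSegment μ = funToFin (λ j → μ (inject≤ j L≤m))

  initialSegment-agree : ∀ μ μ′ → initialSegment μ ≡ initialSegment μ′ → ∀ x → toℕ x < L → μ x ≡ μ′ x
  initialSegment-agree μ μ′ eq x x<L = begin
    μ x                           ≡⟨ cong μ ix≡x ⟨
    μ (inject≤ i L≤m)             ≡⟨ finToFun-funToFin (λ j → μ (inject≤ j L≤m)) i ⟨
    finToFun (initialSegment μ) i ≡⟨ cong (λ c → finToFun c i) eq ⟩
    finToFun (initialSegment μ′) i ≡⟨ finToFun-funToFin (λ j → μ′ (inject≤ j L≤m)) i ⟩
    μ′ (inject≤ i L≤m)            ≡⟨ cong μ′ ix≡x ⟩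
    μ′ x                          ∎
    where
      open ≡-Reasoning
      i = fromℕ< x<L
      ix≡x : inject≤ i L≤m ≡ x
      ix≡x = toℕ-injective (trans (toℕ-inject≤ i L≤m) (toℕ-fromℕ< x<L))

  shortRotation-determined : ∀ μ μ′ p → 1 ≤ p → p ≤ L → Commute μ (rot p) → Commute μ′ (rot p) →
    initialSegment μ ≡ initialSegment μ′ → μ ≗ μ′
  shortRotation-determined μ μ′ p 1≤p p≤L μp≡pμ μ′p≡pμ′ eq x = <-rec P step (toℕ x) x refl
    where
      P : ℕ → Set
      P t = ∀ x → toℕ x ≡ t → μ x ≡ μ′ x
      step : ∀ t → (∀ {s} → s < t → P s) → P t
      step t rec x refl with toℕ x <? p
      ... | yes x<p = initialSegment-agree μ μ′ eq x (<-≤-trans x<p p≤L)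
      ... | no x≮p = begin
        μ x                ≡⟨ cong μ ry≡x ⟨
        μ (rot p y)        ≡⟨ μp≡pμ y ⟩
        rot p (μ y)        ≡⟨ cong (rot p) (rec y<x y refl) ⟩
        rot p (μ′ y)       ≡⟨ μ′p≡pμ′ y ⟨
        μ′ (rot p y)       ≡⟨ cong μ′ ry≡x ⟩
        μ′ x               ∎
        where
          open ≡-Reasoning
          p≤x = ≮⇒≥ x≮p
          x∸p<m = ≤-<-trans (m∸n≤m (toℕ x) p) (toℕ<n x)
          y = fromℕ< x∸p<m
          y<x : toℕ y < toℕ x
          y<x = subst (_< toℕ x) (sym (toℕ-fromℕ< x∸p<m)) (∸-monoʳ-< 1≤p p≤x)
          ry≡x : rot p y ≡ x
          ry≡x = toℕ-injective (begin
            toℕ (rot p y)          ≡⟨ toℕ-rot p y ⟩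
            (toℕ y + p) % m        ≡⟨ cong (λ z → (z + p) % m) (toℕ-fromℕ< x∸p<m) ⟩
            (toℕ x ∸ p + p) % m    ≡⟨ cong (_% m) (m∸n+n≡m p≤x) ⟩
            toℕ x % m              ≡⟨ m<n⇒m%n≡m (toℕ<n x) ⟩
            toℕ x                  ∎)

  module RotationConjugation (t : ℕ) = Conjugation (rot t) (rot (negₘ t)) (rot-negₘ t) (rot-negₘ′ t)

  rotationConjugation-reflection : ∀ t A → RotationConjugation.conj t (affine true A) ≗ affine true (A + t + t)
  rotationConjugation-reflection t A x = begin
    rot t (affine true A (rot (negₘ t) x))        ≡⟨ cong (rot t) (affine-affine false (negₘ t) true A x) ⟩
    rot t (affine true (A + negₘ (negₘ t)) x)     ≡⟨ affine-affine true (A + negₘ (negₘ t)) false t x ⟩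
    affine true (A + negₘ (negₘ t) + t) x         ≡⟨ affine-congₘ true (+-congʳₘ t (+-congˡₘ A (negₘ-negₘ t))) x ⟩
    affine true (A + t + t) x                     ∎
    where open ≡-Reasoning

  -- Conjugating by the rotation through n − ⌊A/2⌋ makes the reflection axis standard.
  reflection-normalForm : ∀ A → A < m → Σ (Fin m) λ t → RotationConjugation.conj (toℕ t) (affine true A) ≗ affine true (A % 2)
  reflection-normalForm A A<m = t , λ x → trans (rotationConjugation-reflection (toℕ t) A x) (affine-congₘ true A+2t≡ x)
    where
      u = A / 2
      u<n : u < n
      u<n = *-cancelʳ-< 2 u n (≤-<-trans (m/n*n≤m A 2) (subst (A <_) (*-comm 2 n) A<m))
      t : Fin m
      t = fromℕ< (≤-<-trans (m∸n≤m n u) n<m)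
      t≡ : toℕ t ≡ n ∸ u
      t≡ = toℕ-fromℕ< _
      regroup : ∀ r u t → r + u * 2 + t + t ≡ r + ((u + t) + (u + t))
      regroup = solve-∀
      A+2t≡ : A + toℕ t + toℕ t ≡ₘ A % 2
      A+2t≡ = begin
        A + toℕ t + toℕ t                       ≡⟨ cong (λ z → z + toℕ t + toℕ t) (m≡m%n+[m/n]*n A 2) ⟩
        A % 2 + u * 2 + toℕ t + toℕ t           ≡⟨ regroup (A % 2) u (toℕ t) ⟩
        A % 2 + ((u + toℕ t) + (u + toℕ t))     ≡⟨ cong (λ z → A % 2 + (z + z)) (trans (cong (u +_) t≡) (m+[n∸m]≡n (<⇒≤ u<n))) ⟩
        A % 2 + (n + n)                         ≡⟨ cong (A % 2 +_) m≡n+n ⟨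
        A % 2 + m                               ≈⟨ +-congˡₘ (A % 2) m≡ₘ0 ⟩
        A % 2 + 0                               ≡⟨ +-identityʳ (A % 2) ⟩
        A % 2                                   ∎
        where open SetoidReasoning ≡ₘ-setoid

  module HalfTurnSymmetric = Commuting halfTurn halfTurn-involutive (<⇒≤ n<m) halfTurn-covers halfTurn-fixes
  module EdgeReflectionSymmetric = Commuting opposite opposite-involutive (<⇒≤ n<m) opposite-covers opposite-fixes
  module VertexReflectionSymmetric = Commuting negation negation-involutive n<m negation-covers negation-fixes

  halfTurnCount vertexReflectionCount : ℕ
  halfTurnCount = 2 ^ n * involutionCount n
  vertexReflectionCount = 2 ^ suc n * involutionCount (suc n)

  data StabiliserCode : Set where
    halfTurnCode : Fin halfTurnCount → StabiliserCode
    edgeReflectionCode : Fin m → Fin halfTurnCount → StabiliserCode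
    vertexReflectionCode : Fin m → Fin vertexReflectionCount → StabiliserCode
    shortRotationCode : Fin (suc L) → Fin (m ^ L) → StabiliserCode

  Encodes : (μ : Endo m) → Involutive _≡_ μ → StabiliserCode → Set
  Encodes μ μ-inv (halfTurnCode c) =
    Σ (Commute μ halfTurn) λ comm → HalfTurnSymmetric.code μ μ-inv comm ≡ c
  Encodes μ μ-inv (edgeReflectionCode t c) =
    Σ (Commute μ′ opposite) λ comm → EdgeReflectionSymmetric.code μ′ (conj-involutive μ μ-inv) comm ≡ c
    where open RotationConjugation (toℕ t)
          μ′ = conj μ
  Encodes μ μ-inv (vertexReflectionCode t c) =
    Σ (Commute μ′ negation) λ comm → VertexReflectionSymmetric.code μ′ (conj-involutive μ μ-inv) comm ≡ c
    where open RotationConjugation (toℕ t)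
          μ′ = conj μ
  Encodes μ μ-inv (shortRotationCode p c) = 1 ≤ toℕ p × Commute μ (rot (toℕ p)) × initialSegment μ ≡ c

  encodes-injective : ∀ {μ μ′ μ-inv μ′-inv} c → Encodes μ μ-inv c → Encodes μ′ μ′-inv c → μ ≗ μ′
  encodes-injective {μ} {μ′} {μ-inv} {μ′-inv} (halfTurnCode c) (comm , eq) (comm′ , eq′) =
    HalfTurnSymmetric.code-injective μ μ′ μ-inv comm μ′-inv comm′ (trans eq (sym eq′))
  encodes-injective {μ} {μ′} {μ-inv} {μ′-inv} (edgeReflectionCode t c) (comm , eq) (comm′ , eq′) =
    conj-injective (EdgeReflectionSymmetric.code-injective _ _ (conj-involutive μ μ-inv) comm (conj-involutive μ′ μ′-inv) comm′ (trans eq (sym eq′)))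
    where open RotationConjugation (toℕ t)
  encodes-injective {μ} {μ′} {μ-inv} {μ′-inv} (vertexReflectionCode t c) (comm , eq) (comm′ , eq′) =
    conj-injective (VertexReflectionSymmetric.code-injective _ _ (conj-involutive μ μ-inv) comm (conj-involutive μ′ μ′-inv) comm′ (trans eq (sym eq′)))
    where open RotationConjugation (toℕ t)
  encodes-injective {μ} {μ′} (shortRotationCode p c) (1≤p , comm , eq) (_ , comm′ , eq′) =
    shortRotation-determined μ μ′ (toℕ p) 1≤p (≤-pred (toℕ<n p)) comm comm′ (trans eq (sym eq′))

  normalisedReflectionCode : ∀ μ μ-inv (t : Fin m) r → r < 2 → Commute (RotationConjugation.conj (toℕ t) μ) (affine true r) →
    Σ StabiliserCode (Encodes μ μ-inv)
  normalisedReflectionCode μ μ-inv t zero _ comm =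
    edgeReflectionCode t (EdgeReflectionSymmetric.code (conj μ) (conj-involutive μ μ-inv) comm′) , comm′ , refl
    where
      open RotationConjugation (toℕ t)
      comm′ = commute-respʳ-≗ {f = affine true 0} {g = opposite} (λ x → rot-zero (opposite x)) {h = conj μ} comm
  normalisedReflectionCode μ μ-inv t (suc zero) _ comm =
    vertexReflectionCode t (VertexReflectionSymmetric.code (conj μ) (conj-involutive μ μ-inv) comm) , comm , refl
    where open RotationConjugation (toℕ t)
  normalisedReflectionCode μ μ-inv t (suc (suc r)) (s≤s (s≤s ())) _

  reflectionCode : ∀ μ μ-inv A → A < m → Commute μ (affine true A) → Σ StabiliserCode (Encodes μ μ-inv)
  reflectionCode μ μ-inv A A<m comm = normalisedReflectionCode μ μ-inv t (A % 2) (m%n<n A 2)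
    (commute-respʳ-≗ {f = conj (affine true A)} {g = affine true (A % 2)} conj≗ {h = conj μ} (conj-commute μ (affine true A) comm))
    where
      t = proj₁ (reflection-normalForm A A<m)
      conj≗ = proj₂ (reflection-normalForm A A<m)
      open RotationConjugation (toℕ t)

  shortRotationCode′ : ∀ μ μ-inv → ShortRotationSymmetric μ → Σ StabiliserCode (Encodes μ μ-inv)
  shortRotationCode′ μ μ-inv (p , 1≤p , 3p≤m , comm) =
    shortRotationCode p′ (initialSegment μ) , subst (1 ≤_) (sym p′≡p) 1≤p , subst (λ q → Commute μ (rot q)) (sym p′≡p) comm , refl
    where
      p′ = fromℕ< (s≤s (subst (_≤ L) (m*n/n≡m p 3) (/-monoˡ-≤ 3 3p≤m)))
      p′≡p = toℕ-fromℕ< _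

  rotationCode : ∀ μ μ-inv A → A < m → Commute μ (rot A) → ¬ (∀ (x : Fin m) → rot A x ≡ x) → Σ StabiliserCode (Encodes μ μ-inv)
  rotationCode μ μ-inv zero _ _ A≢id = ⊥-elim (A≢id rot-zero)
  rotationCode μ μ-inv (suc A) A<m comm _ with rotationSymmetry μ (s≤s z≤n) A<m comm
  ... | inj₁ comm′ = halfTurnCode (HalfTurnSymmetric.code μ μ-inv comm′) , comm′ , refl
  ... | inj₂ short = shortRotationCode′ μ μ-inv short

  stabiliserCode : ∀ μ μ-inv (g : Dihedral n) → Commute ⟦ g ⟧ μ → ¬ (∀ x → ⟦ g ⟧ x ≡ x) → Σ StabiliserCode (Encodes μ μ-inv)
  stabiliserCode μ μ-inv (a , true) gμ≡μg _ =
    reflectionCode μ μ-inv (toℕ a) (toℕ<n a) (commute-sym {f = ⟦ a , true ⟧} {g = μ} gμ≡μg)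
  stabiliserCode μ μ-inv (a , false) gμ≡μg g≢id =
    rotationCode μ μ-inv (toℕ a) (toℕ<n a) (commute-sym {f = ⟦ a , false ⟧} {g = μ} gμ≡μg) g≢id

  shortRotationCount vertexOrShortCount reflectionOrShortCount stabiliserCodeCount : ℕ
  shortRotationCount = suc L * m ^ L
  vertexOrShortCount = m * vertexReflectionCount + shortRotationCount
  reflectionOrShortCount = m * halfTurnCount + vertexOrShortCount
  stabiliserCodeCount = halfTurnCount + reflectionOrShortCount

  toFin : StabiliserCode → Fin stabiliserCodeCount
  toFin (halfTurnCode c) = c ↑ˡ reflectionOrShortCount
  toFin (edgeReflectionCode t c) = halfTurnCount ↑ʳ (combine t c ↑ˡ vertexOrShortCount)
  toFin (vertexReflectionCode t c) = halfTurnCount ↑ʳ (m * halfTurnCount ↑ʳ (combine t c ↑ˡ shortRotationCount))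
  toFin (shortRotationCode p c) = halfTurnCount ↑ʳ (m * halfTurnCount ↑ʳ (m * vertexReflectionCount ↑ʳ combine p c))

  fromFin : Fin stabiliserCodeCount → StabiliserCode
  fromFin = [ halfTurnCode , [ uncurry edgeReflectionCode ∘ remQuot halfTurnCount , fromVertexOrShort ]′ ∘ splitAt (m * halfTurnCount) ]′
            ∘ splitAt halfTurnCount
    where
      fromVertexOrShort : Fin vertexOrShortCount → StabiliserCode
      fromVertexOrShort = [ uncurry vertexReflectionCode ∘ remQuot vertexReflectionCount , uncurry shortRotationCode ∘ remQuot (m ^ L) ]′
                          ∘ splitAt (m * vertexReflectionCount)

  fromFin-toFin : ∀ c → fromFin (toFin c) ≡ c
  fromFin-toFin (halfTurnCode c) rewrite splitAt-↑ˡ halfTurnCount c reflectionOrShortCount = refl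
  fromFin-toFin (edgeReflectionCode t c)
    rewrite splitAt-↑ʳ halfTurnCount reflectionOrShortCount (combine t c ↑ˡ vertexOrShortCount)
          | splitAt-↑ˡ (m * halfTurnCount) (combine t c) vertexOrShortCount
          = cong (uncurry edgeReflectionCode) (remQuot-combine t c)
  fromFin-toFin (vertexReflectionCode t c)
    rewrite splitAt-↑ʳ halfTurnCount reflectionOrShortCount (m * halfTurnCount ↑ʳ (combine t c ↑ˡ shortRotationCount))
          | splitAt-↑ʳ (m * halfTurnCount) vertexOrShortCount (combine t c ↑ˡ shortRotationCount)
          | splitAt-↑ˡ (m * vertexReflectionCount) (combine t c) shortRotationCount
          = cong (uncurry vertexReflectionCode) (remQuot-combine t c)
  fromFin-toFin (shortRotationCode p c)
    rewrite splitAt-↑ʳ halfTurnCount reflectionOrShortCount (m * halfTurnCount ↑ʳ (m * vertexReflectionCount ↑ʳ combine p c))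
          | splitAt-↑ʳ (m * halfTurnCount) vertexOrShortCount (m * vertexReflectionCount ↑ʳ combine p c)
          | splitAt-↑ʳ (m * vertexReflectionCount) shortRotationCount (combine p c)
          = cong (uncurry shortRotationCode) (remQuot-combine p c)

  toFin-injective : ∀ {c c′} → toFin c ≡ toFin c′ → c ≡ c′
  toFin-injective {c} {c′} eq = trans (sym (fromFin-toFin c)) (trans (cong fromFin eq) (fromFin-toFin c′))

module ClassBounds (n′ : ℕ) (1≤n′ : 1 ≤ n′) (d : ℕ) (classes : ClassCount (suc n′) d) where

  open import Defs using (ClassCount; Diagram; Equivalent; Dihedral)
  open import Data.Nat using (ℕ; suc; _≤_; _+_; _*_)
  open import Algebra.Definitions using (Involutive)
  open import Data.Empty using (⊥-elim)
  open import Data.Fin using (Fin; combine; remQuot; _↑ˡ_; _↑ʳ_)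
  open import Data.Fin.Properties using (_≟_; *↔×; 2↔Bool; combine-injective; ↑ˡ-injective; ↑ʳ-injective; all?; ¬∀⟶∃¬; injective⇒≤)
  open import Data.Product using (Σ; _×_; _,_; proj₁; proj₂)
  open import Data.Product.Properties using (×-≡,≡→≡)
  open import Data.Product.Function.NonDependent.Propositional using (_×-↔_)
  open import Data.Vec using (lookup)
  open import Function using (Inverse; _↔_)
  open import Function.Construct.Composition using (_↔-∘_)
  open import Function.Construct.Identity using (↔-id)
  open import Relation.Binary.PropositionalEquality using (_≡_; _≗_; refl; sym; trans; cong; subst; module ≡-Reasoning)
  open import Relation.Nullary using (Dec; yes; no; ¬_)
  open import Relation.Nullary.Decidable using (_→-dec_)
  open Involutions
  open DihedralAction n′
  open Stabilisers n′

  elements : Fin (m * 2) ↔ Dihedral n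
  elements = (↔-id _ ×-↔ 2↔Bool) ↔-∘ *↔×

  open Inverse elements using () renaming (to to elementAt; from to indexOf; strictlyInverseˡ to elementAt-indexOf; strictlyInverseʳ to indexOf-elementAt)

  indexOf-injective : ∀ {g h} → indexOf g ≡ indexOf h → g ≡ h
  indexOf-injective {g} {h} eq = trans (sym (elementAt-indexOf g)) (trans (cong elementAt eq) (elementAt-indexOf h))

  module GroupConjugation (g : Dihedral n) = Conjugation ⟦ g ⟧ ⟦ g ⁻¹ ⟧ (act-⁻¹′ g) (act-⁻¹ g)

  conj-equal⇒related : ∀ g h {μ ν} → GroupConjugation.conj g μ ≗ GroupConjugation.conj h ν →
    ∀ x → ⟦ h ⁻¹ ∙ g ⟧ (μ x) ≡ ν (⟦ h ⁻¹ ∙ g ⟧ x)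
  conj-equal⇒related g h {μ} {ν} eq x = begin
    ⟦ h ⁻¹ ∙ g ⟧ (μ x)                                  ≡⟨ act-∙ (h ⁻¹) g (μ x) ⟩
    ⟦ h ⁻¹ ⟧ (⟦ g ⟧ (μ x))                              ≡⟨ cong (λ y → ⟦ h ⁻¹ ⟧ (⟦ g ⟧ (μ y))) (act-⁻¹ g x) ⟨
    ⟦ h ⁻¹ ⟧ (⟦ g ⟧ (μ (⟦ g ⁻¹ ⟧ (⟦ g ⟧ x))))            ≡⟨ cong ⟦ h ⁻¹ ⟧ (eq (⟦ g ⟧ x)) ⟩
    ⟦ h ⁻¹ ⟧ (⟦ h ⟧ (ν (⟦ h ⁻¹ ⟧ (⟦ g ⟧ x))))            ≡⟨ act-⁻¹ h _ ⟩
    ν (⟦ h ⁻¹ ⟧ (⟦ g ⟧ x))                              ≡⟨ cong ν (act-∙ (h ⁻¹) g x) ⟨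
    ν (⟦ h ⁻¹ ∙ g ⟧ x)                                  ∎
    where open ≡-Reasoning

  fromMatching : FPFInvolution m → Diagram n
  fromMatching (μ , μ-inv , μ-fpf) = μ , λ x → μ-inv x , μ-fpf x

  representative : Fin d → Diagram n
  representative i = lookup (proj₁ classes) i

  μ : Fin d → Endo m
  μ i = proj₁ (representative i)

  μ-involutive : ∀ i → Involutive _≡_ (μ i)
  μ-involutive i x = proj₁ (proj₂ (representative i) x)

  μ-fixedPointFree : ∀ i → FixedPointFree (μ i)
  μ-fixedPointFree i x = proj₂ (proj₂ (representative i) x)

  representative-injective : ∀ {i j} → Equivalent n (representative i) (representative j) → i ≡ j
  representative-injective {i} {j} i∼j with i ≟ j
  ... | yes i≡j = i≡j
  ... | no i≢j = ⊥-elim (proj₁ (proj₂ classes) i j i≢j i∼j)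

  ClassWitness : Diagram n → Set
  ClassWitness Γ = Σ (Fin d) λ i → Equivalent n Γ (representative i)

  classOf : (Γ : Diagram n) → ClassWitness Γ
  classOf = proj₂ (proj₂ classes)

  witnessLabel : ∀ {Γ} → ClassWitness Γ → Fin (d * (m * 2))
  witnessLabel (i , g , _) = combine i (indexOf g)

  witnessLabel-injective : ∀ {Γ Γ′} (w : ClassWitness Γ) (w′ : ClassWitness Γ′) → witnessLabel {Γ} w ≡ witnessLabel {Γ′} w′ → proj₁ Γ ≗ proj₁ Γ′
  witnessLabel-injective (i , g , rel) (i′ , g′ , rel′) eq with combine-injective i (indexOf g) i′ (indexOf g′) eq
  ... | refl , same-index with indexOf-injective {g} {g′} same-index
  ...   | refl = λ x → act-injective g (trans (rel x) (sym (rel′ x)))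

  matchingCount≤ : matchingCount m ≤ d * (m * 2)
  matchingCount≤ = injective⇒≤ {f = label} λ {c} {c′} eq → decodeMatching-injective m (witnessLabel-injective {diagram c} {diagram c′} (classOf _) (classOf _) eq)
    where
      diagram : Fin (matchingCount m) → Diagram n
      diagram c = fromMatching (decodeMatching m c)
      label : Fin (matchingCount m) → Fin (d * (m * 2))
      label c = witnessLabel {diagram c} (classOf (diagram c))

  Trivial : Dihedral n → Set
  Trivial g = ∀ x → ⟦ g ⟧ x ≡ x

  Free : Endo m → Set
  Free ν = ∀ j → Commute ⟦ elementAt j ⟧ ν → Trivial (elementAt j)

  commute? : ∀ g ν → Dec (Commute ⟦ g ⟧ ν)
  commute? g ν = all? λ x → ⟦ g ⟧ (ν x) ≟ ν (⟦ g ⟧ x)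

  trivial? : ∀ g → Dec (Trivial g)
  trivial? g = all? λ x → ⟦ g ⟧ x ≟ x

  free? : ∀ ν → Dec (Free ν)
  free? ν = all? λ j → commute? (elementAt j) ν →-dec trivial? (elementAt j)

  free-trivial : ∀ {ν} → Free ν → ∀ g → Commute ⟦ g ⟧ ν → Trivial g
  free-trivial {ν} free g gν≡νg = subst Trivial (elementAt-indexOf g) (free (indexOf g) (subst (λ h → Commute ⟦ h ⟧ ν) (sym (elementAt-indexOf g)) gν≡νg))

  nontrivialSymmetry : ∀ ν → ¬ Free ν → Σ (Dihedral n) λ g → Commute ⟦ g ⟧ ν × ¬ Trivial g
  nontrivialSymmetry ν not-free with ¬∀⟶∃¬ (m * 2) _ (λ j → commute? (elementAt j) ν →-dec trivial? (elementAt j)) not-free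
  ... | j , ¬implication with commute? (elementAt j) ν | trivial? (elementAt j)
  ...   | yes comm | no nontrivial = elementAt j , comm , nontrivial
  ...   | yes _ | yes trivial = ⊥-elim (¬implication (λ _ → trivial))
  ...   | no noncomm | _ = ⊥-elim (¬implication (λ comm → ⊥-elim (noncomm comm)))

  labelCount : ℕ
  labelCount = matchingCount m + stabiliserCodeCount * (m * 2)

  conjugateRepresentative : Fin d → Dihedral n → Fin (matchingCount m)
  conjugateRepresentative i g = encodeMatching m (conj (μ i)) (conj-involutive (μ i) (μ-involutive i)) (conj-fixedPointFree (μ i) (μ-fixedPointFree i))
    where open GroupConjugation g

  symmetryCode : ∀ i → ¬ Free (μ i) → StabiliserCode
  symmetryCode i not-free = proj₁ (stabiliserCode (μ i) (μ-involutive i) g (proj₁ g-props) (proj₂ g-props))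
    where
      g = proj₁ (nontrivialSymmetry (μ i) not-free)
      g-props = proj₂ (nontrivialSymmetry (μ i) not-free)

  symmetryCode-encodes : ∀ i not-free → Encodes (μ i) (μ-involutive i) (symmetryCode i not-free)
  symmetryCode-encodes i not-free = proj₂ (stabiliserCode (μ i) (μ-involutive i) g (proj₁ g-props) (proj₂ g-props))
    where
      g = proj₁ (nontrivialSymmetry (μ i) not-free)
      g-props = proj₂ (nontrivialSymmetry (μ i) not-free)

  -- The 4n images of a representative with trivial stabiliser are distinct matchings; every other
  -- class is labelled by a stabiliser code of its representative.
  upperLabel : ∀ i → Dihedral n → Dec (Free (μ i)) → Fin labelCount
  upperLabel i g (yes _) = conjugateRepresentative i g ↑ˡ _
  upperLabel i g (no not-free) = matchingCount m ↑ʳ combine (toFin (symmetryCode i not-free)) (indexOf g)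

  upperLabel-injective : ∀ i i′ g g′ di di′ → upperLabel i g di ≡ upperLabel i′ g′ di′ → i ≡ i′ × g ≡ g′
  upperLabel-injective i i′ g g′ (yes free) (yes _) eq
    with representative-injective {i} {i′} (g′ ⁻¹ ∙ g , conj-equal⇒related g g′ {μ i} {μ i′} same-conjugates)
    where
      same-conjugates = encodeMatching-injective m _ _ _ _ _ _ (↑ˡ-injective _ _ _ eq)
  ... | refl = refl , act-faithful 1≤n′ λ x → begin
    ⟦ g ⟧ x                      ≡⟨ act-⁻¹′ g′ (⟦ g ⟧ x) ⟨
    ⟦ g′ ⟧ (⟦ g′ ⁻¹ ⟧ (⟦ g ⟧ x))  ≡⟨ cong ⟦ g′ ⟧ (act-∙ (g′ ⁻¹) g x) ⟨
    ⟦ g′ ⟧ (⟦ g′ ⁻¹ ∙ g ⟧ x)      ≡⟨ cong ⟦ g′ ⟧ (free-trivial free (g′ ⁻¹ ∙ g) (conj-equal⇒related g g′ {μ i} {μ i′} same-conjugates) x) ⟩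
    ⟦ g′ ⟧ x                     ∎
    where
      open ≡-Reasoning
      same-conjugates = encodeMatching-injective m _ _ _ _ _ _ (↑ˡ-injective _ _ _ eq)
  upperLabel-injective i i′ g g′ (yes _) (no _) eq = ⊥-elim (↑ˡ≢↑ʳ _ _ eq)
  upperLabel-injective i i′ g g′ (no _) (yes _) eq = ⊥-elim (↑ˡ≢↑ʳ _ _ (sym eq))
  upperLabel-injective i i′ g g′ (no not-free) (no not-free′) eq
    with combine-injective _ (indexOf g) _ (indexOf g′) (↑ʳ-injective (matchingCount m) _ _ eq)
  ... | same-code , same-index = representative-injective (identity , λ x → begin
    ⟦ identity ⟧ (μ i x)      ≡⟨ act-identity (μ i x) ⟩
    μ i x                     ≡⟨ same-μ x ⟩
    μ i′ x                    ≡⟨ cong (μ i′) (act-identity x) ⟨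
    μ i′ (⟦ identity ⟧ x)     ∎) , indexOf-injective {g} {g′} same-index
    where
      open ≡-Reasoning
      same-μ : μ i ≗ μ i′
      same-μ = encodes-injective {μ i} {μ i′} {μ-involutive i} {μ-involutive i′} (symmetryCode i not-free) (symmetryCode-encodes i not-free)
        (subst (Encodes (μ i′) (μ-involutive i′)) (sym (toFin-injective same-code)) (symmetryCode-encodes i′ not-free′))

  ≤labelCount : d * (m * 2) ≤ labelCount
  ≤labelCount = injective⇒≤ {f = label} λ {t} {t′} eq →
    label-injective t t′ (upperLabel-injective (classPart t) (classPart t′) (elementPart t) (elementPart t′) (free? _) (free? _) eq)
    where
      classPart : Fin (d * (m * 2)) → Fin d
      classPart t = proj₁ (remQuot (m * 2) t)
      elementPart : Fin (d * (m * 2)) → Dihedral n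
      elementPart t = elementAt (proj₂ (remQuot {d} (m * 2) t))
      label : Fin (d * (m * 2)) → Fin labelCount
      label t = upperLabel (classPart t) (elementPart t) (free? (μ (classPart t)))
      label-injective : ∀ t t′ → classPart t ≡ classPart t′ × elementPart t ≡ elementPart t′ → t ≡ t′
      label-injective t t′ (same-class , same-element) = remQuot-injective (m * 2) (×-≡,≡→≡ (same-class ,
        trans (sym (indexOf-elementAt _)) (trans (cong indexOf same-element) (indexOf-elementAt _))))

module Estimates where

  open import Defs using (oddDoubleFact)
  open import Data.Nat using (ℕ; zero; suc; _+_; _*_; _^_; _∸_; _≤_; _<_; z≤n; s≤s; NonZero; >-nonZero)
  open import Data.Nat.DivMod using (_/_; m/n*n≤m; m≡m%n+[m/n]*n; m%n<n; m*n/n≡m; /-monoˡ-≤)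
  open import Data.Nat.Properties
  open import Data.Nat.Tactic.RingSolver using (solve-∀)
  open import Data.Product using (_,_; ∃)
  open import Data.Sum using (inj₁; inj₂)
  open import Relation.Binary.PropositionalEquality using (_≡_; refl; sym; trans; cong; cong₂; subst; subst₂)
  open Involutions using (matchingCount; involutionCount)

  open ≤-Reasoning

  matchingCount-double : ∀ n → matchingCount (2 * n) ≡ oddDoubleFact n
  matchingCount-double zero = refl
  matchingCount-double (suc n) = begin-equality
    matchingCount (2 * suc n)               ≡⟨ cong matchingCount (double-suc n) ⟩
    suc (2 * n) * matchingCount (2 * n)     ≡⟨ cong₂ _*_ (+-comm 1 (2 * n)) (matchingCount-double n) ⟩
    (2 * n + 1) * oddDoubleFact n           ∎
    where
      double-suc : ∀ x → 2 * suc x ≡ suc (suc (2 * x))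
      double-suc = solve-∀

  oddDoubleFact-positive : ∀ n → 1 ≤ oddDoubleFact n
  oddDoubleFact-positive zero = ≤-refl
  oddDoubleFact-positive (suc n) = *-mono-≤ (m≤n+m 1 (2 * n)) (oddDoubleFact-positive n)

  oddDoubleFact-≥-top : ∀ j d → (2 * j + 1) ^ d ≤ oddDoubleFact (j + d)
  oddDoubleFact-≥-top j zero = oddDoubleFact-positive (j + 0)
  oddDoubleFact-≥-top j (suc d) = begin
    (2 * j + 1) * (2 * j + 1) ^ d          ≤⟨ *-mono-≤ (+-monoˡ-≤ 1 (*-monoʳ-≤ 2 (m≤m+n j d))) (oddDoubleFact-≥-top j d) ⟩
    (2 * (j + d) + 1) * oddDoubleFact (j + d) ≡⟨ cong oddDoubleFact (+-suc j d) ⟨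
    oddDoubleFact (j + suc d)              ∎

  oddDoubleFact-≥ : ∀ {j n} → j ≤ n → (2 * j + 1) ^ (n ∸ j) ≤ oddDoubleFact n
  oddDoubleFact-≥ {j} {n} j≤n = subst (λ z → (2 * j + 1) ^ (n ∸ j) ≤ oddDoubleFact z) (m+[n∸m]≡n j≤n) (oddDoubleFact-≥-top j (n ∸ j))

  ^-distribʳ-* : ∀ a b c → (a * b) ^ c ≡ a ^ c * b ^ c
  ^-distribʳ-* a b zero = refl
  ^-distribʳ-* a b (suc c) = trans (cong (a * b *_) (^-distribʳ-* a b c)) (interchange a b (a ^ c) (b ^ c))
    where
      interchange : ∀ a b x y → a * b * (x * y) ≡ a * x * (b * y)
      interchange = solve-∀

  ^-mono-≤ : ∀ {a b c d} → 1 ≤ a → a ≤ b → c ≤ d → a ^ c ≤ b ^ d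
  ^-mono-≤ {suc a} {b} {c} {d} _ a≤b c≤d = ≤-trans (^-monoʳ-≤ (suc a) c≤d) (^-monoˡ-≤ d a≤b)

  ^-cancelʳ-≤ : ∀ c .{{_ : NonZero c}} {a b} → a ^ c ≤ b ^ c → a ≤ b
  ^-cancelʳ-≤ c {a} {b} aᶜ≤bᶜ = ≮⇒≥ λ b<a → <⇒≱ (^-monoˡ-< c b<a) aᶜ≤bᶜ

  square-sixth : ∀ x → (x * x) ^ 3 ≡ x ^ 6
  square-sixth x = trans (cong (_^ 3) (cong (x *_) (sym (*-identityʳ x)))) (^-*-assoc x 2 3)

  sum-square-≤ : ∀ {a b X} → a * a ≤ X → b * b ≤ X → (a + b) * (a + b) ≤ 4 * X
  sum-square-≤ {a} {b} {X} a²≤X b²≤X with ≤-total a b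
  ... | inj₁ a≤b = begin
    (a + b) * (a + b)   ≤⟨ *-mono-≤ (+-monoˡ-≤ b a≤b) (+-monoˡ-≤ b a≤b) ⟩
    (b + b) * (b + b)   ≡⟨ double-square b ⟩
    4 * (b * b)         ≤⟨ *-monoʳ-≤ 4 b²≤X ⟩
    4 * X               ∎
    where
      double-square : ∀ x → (x + x) * (x + x) ≡ 4 * (x * x)
      double-square = solve-∀
  ... | inj₂ b≤a = begin
    (a + b) * (a + b)   ≤⟨ *-mono-≤ (+-monoʳ-≤ a b≤a) (+-monoʳ-≤ a b≤a) ⟩
    (a + a) * (a + a)   ≡⟨ double-square a ⟩
    4 * (a * a)         ≤⟨ *-monoʳ-≤ 4 a²≤X ⟩
    4 * X               ∎
    where
      double-square : ∀ x → (x + x) * (x + x) ≡ 4 * (x * x)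
      double-square = solve-∀

  involutionCount-square : ∀ K → involutionCount K * involutionCount K ≤ 4 ^ K * suc K ^ K
  involutionCount-square K = proj₁ (consecutive K)
    where
      open Data.Product using (_×_; proj₁; proj₂)
      Bound : ℕ → Set
      Bound K = involutionCount K * involutionCount K ≤ 4 ^ K * suc K ^ K
      consecutive : ∀ K → Bound K × Bound (suc K)
      consecutive zero = ≤-refl , s≤s z≤n
      consecutive (suc K) = proj₂ (consecutive K) ,
        subst (involutionCount (suc (suc K)) * involutionCount (suc (suc K)) ≤_) (sym (*-assoc 4 (4 ^ suc K) _))
          (sum-square-≤ {involutionCount (suc K)} {suc K * involutionCount K} {X} last-term-bound new-term-bound)
        where
          X = 4 ^ suc K * suc (suc (suc K)) ^ suc (suc K)
          last-term-bound : involutionCount (suc K) * involutionCount (suc K) ≤ X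
          last-term-bound = ≤-trans (proj₂ (consecutive K))
            (*-monoʳ-≤ (4 ^ suc K) (^-mono-≤ {suc (suc K)} {suc (suc (suc K))} {suc K} (s≤s z≤n) (n≤1+n _) (n≤1+n _)))
          new-term-bound : (suc K * involutionCount K) * (suc K * involutionCount K) ≤ X
          new-term-bound = begin
            (suc K * involutionCount K) * (suc K * involutionCount K) ≡⟨ square-* (suc K) (involutionCount K) ⟩
            (suc K * suc K) * (involutionCount K * involutionCount K) ≤⟨ *-monoʳ-≤ (suc K * suc K) (proj₁ (consecutive K)) ⟩
            (suc K * suc K) * (4 ^ K * suc K ^ K)                   ≡⟨ regroup (suc K) (4 ^ K) (suc K ^ K) ⟩
            4 ^ K * suc K ^ suc (suc K)                             ≤⟨ *-mono-≤ (^-monoʳ-≤ 4 (n≤1+n K)) (^-monoˡ-≤ (suc (suc K)) (≤-trans (n≤1+n _) (n≤1+n _))) ⟩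
            X                                                       ∎
            where
              square-* : ∀ x y → (x * y) * (x * y) ≡ (x * x) * (y * y)
              square-* = solve-∀
              regroup : ∀ x p q → (x * x) * (p * q) ≡ p * (x * (x * q))
              regroup = solve-∀

  power-dominates : ∀ A B y → 1 ≤ y → A * B ≤ y → A * B ^ y ≤ y ^ y
  power-dominates zero B y _ _ = z≤n
  power-dominates A@(suc _) B y@(suc y′) _ AB≤y = begin
    A * B ^ y          ≤⟨ *-monoˡ-≤ (B ^ y) (m≤m*n A (A ^ y′) {{A^y′-nonZero}}) ⟩
    A ^ y * B ^ y      ≡⟨ ^-distribʳ-* A B y ⟨
    (A * B) ^ y        ≤⟨ ^-monoˡ-≤ y AB≤y ⟩
    y ^ y              ∎
    where A^y′-nonZero = m^n≢0 A y′

  -- Z n bounds the sixth power of each summand of the stabiliser code count; sixth powers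
  -- make the exponent 2n/3 of the short-rotation codes integral.
  Z : ℕ → ℕ
  Z n = 16 ^ (3 * n + 3) * (2 * n) ^ (4 * n + 9)

  sixth-root : ∀ {X t z q} → X ^ 6 * z ≤ q ^ 6 → t ^ 6 ≤ z → X * t ≤ q
  sixth-root {X} {t} {z} {q} X⁶z≤q⁶ t⁶≤z = ^-cancelʳ-≤ 6 (begin
    (X * t) ^ 6     ≡⟨ ^-distribʳ-* X t 6 ⟩
    X ^ 6 * t ^ 6   ≤⟨ *-monoʳ-≤ (X ^ 6) t⁶≤z ⟩
    X ^ 6 * z       ≤⟨ X⁶z≤q⁶ ⟩
    q ^ 6           ∎)

  Z-bound : ∀ c {n y} → 1 ≤ n → n < y * 8 →
    (c * (2 * n)) ^ 6 * Z n ≤ (16 * c) ^ 6 * 16 ^ 9 * (16 ^ 56) ^ y * y ^ (32 * y + 15)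
  Z-bound c {n} {y} 1≤n n<8y = begin
    (c * (2 * n)) ^ 6 * (16 ^ (3 * n + 3) * (2 * n) ^ (4 * n + 9))
      ≤⟨ *-mono-≤ (^-monoˡ-≤ 6 (*-monoʳ-≤ c 2n≤16y))
                  (*-mono-≤ (^-monoʳ-≤ 16 3n+3≤24y) (^-mono-≤ 1≤2n 2n≤16y (+-monoˡ-≤ 9 4n≤32y))) ⟩
    (c * (16 * y)) ^ 6 * (16 ^ (24 * y) * (16 * y) ^ (32 * y + 9))
      ≡⟨ cong₂ _*_ (trans (cong (_^ 6) (*-assoc-16 c y)) (^-distribʳ-* (16 * c) y 6))
                   (cong (16 ^ (24 * y) *_) (^-distribʳ-* 16 y (32 * y + 9))) ⟩
    (16 * c) ^ 6 * y ^ 6 * (16 ^ (24 * y) * (16 ^ (32 * y + 9) * y ^ (32 * y + 9)))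
      ≡⟨ regroup ((16 * c) ^ 6) (y ^ 6) (16 ^ (24 * y)) (16 ^ (32 * y + 9)) (y ^ (32 * y + 9)) ⟩
    (16 * c) ^ 6 * (16 ^ (24 * y) * 16 ^ (32 * y + 9)) * (y ^ 6 * y ^ (32 * y + 9))
      ≡⟨ cong₂ (λ u v → (16 * c) ^ 6 * u * v) sixteens ys ⟩
    (16 * c) ^ 6 * (16 ^ 9 * (16 ^ 56) ^ y) * y ^ (32 * y + 15)
      ≡⟨ cong (_* y ^ (32 * y + 15)) (sym (*-assoc ((16 * c) ^ 6) (16 ^ 9) ((16 ^ 56) ^ y))) ⟩
    (16 * c) ^ 6 * 16 ^ 9 * (16 ^ 56) ^ y * y ^ (32 * y + 15) ∎
    where
      1≤2n = ≤-trans 1≤n (m≤m+n n (n + 0))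
      2n≤16y : 2 * n ≤ 16 * y
      2n≤16y = subst (2 * n ≤_) (times-8 2 y) (*-monoʳ-≤ 2 (<⇒≤ n<8y))
        where times-8 : ∀ a x → a * (x * 8) ≡ (8 * a) * x
              times-8 = solve-∀
      3n+3≤24y : 3 * n + 3 ≤ 24 * y
      3n+3≤24y = subst₂ _≤_ (times-suc n) (times-24 y) (*-monoʳ-≤ 3 n<8y)
        where times-suc : ∀ x → 3 * suc x ≡ 3 * x + 3
              times-suc = solve-∀
              times-24 : ∀ x → 3 * (x * 8) ≡ 24 * x
              times-24 = solve-∀
      4n≤32y : 4 * n ≤ 32 * y
      4n≤32y = subst (4 * n ≤_) (times-32 y) (*-monoʳ-≤ 4 (<⇒≤ n<8y))
        where times-32 : ∀ x → 4 * (x * 8) ≡ 32 * x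
              times-32 = solve-∀
      *-assoc-16 : ∀ c y → c * (16 * y) ≡ 16 * c * y
      *-assoc-16 = solve-∀
      regroup : ∀ p q r s t → p * q * (r * (s * t)) ≡ p * (r * s) * (q * t)
      regroup = solve-∀
      sixteen-exponent : ∀ x → 24 * x + (32 * x + 9) ≡ 9 + 56 * x
      sixteen-exponent = solve-∀
      y-exponent : ∀ x → 6 + (32 * x + 9) ≡ 32 * x + 15
      y-exponent = solve-∀
      sixteens : 16 ^ (24 * y) * 16 ^ (32 * y + 9) ≡ 16 ^ 9 * (16 ^ 56) ^ y
      sixteens = begin-equality
        16 ^ (24 * y) * 16 ^ (32 * y + 9) ≡⟨ ^-distribˡ-+-* 16 (24 * y) (32 * y + 9) ⟨
        16 ^ (24 * y + (32 * y + 9))      ≡⟨ cong (16 ^_) (sixteen-exponent y) ⟩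
        16 ^ (9 + 56 * y)                 ≡⟨ ^-distribˡ-+-* 16 9 (56 * y) ⟩
        16 ^ 9 * 16 ^ (56 * y)            ≡⟨ cong (16 ^ 9 *_) (^-*-assoc 16 56 y) ⟨
        16 ^ 9 * (16 ^ 56) ^ y            ∎
      ys : y ^ 6 * y ^ (32 * y + 9) ≡ y ^ (32 * y + 15)
      ys = trans (sym (^-distribˡ-+-* y 6 (32 * y + 9))) (cong (y ^_) (y-exponent y))

  oddDoubleFact-≥-eighth : ∀ {j n} → j * 8 ≤ n → suc j ^ (7 * j) ≤ oddDoubleFact n
  oddDoubleFact-≥-eighth {j} {n} 8j≤n = ≤-trans (^-mono-≤ (s≤s z≤n) j+1≤2j+1 7j≤n∸j) (oddDoubleFact-≥ (≤-trans (m≤m*n j 8) 8j≤n))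
    where
      j+1≤2j+1 = subst (suc j ≤_) (+-comm 1 (2 * j)) (s≤s (m≤m+n j (j + 0)))
      7j≤n∸j : 7 * j ≤ n ∸ j
      7j≤n∸j = m+n≤o⇒m≤o∸n (7 * j) (subst (_≤ n) (eight j) 8j≤n)
        where eight : ∀ x → x * 8 ≡ 7 * x + x
              eight = solve-∀

  -- With j = ⌊n/8⌋ and y = j + 1, the left side is at most y ^ (33 y + 15) once y ≥ A * B,
  -- while (2n−1)!! ≥ y ^ (7 j).
  oddDoubleFact-dominates : ∀ c → ∃ λ N → ∀ n → N ≤ n → (c * (2 * n)) ^ 6 * Z n ≤ oddDoubleFact n ^ 6
  oddDoubleFact-dominates c = (A * B + 6) * 8 , bound
    where
      A = (16 * c) ^ 6 * 16 ^ 9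
      B = 16 ^ 56
      bound : ∀ n → (A * B + 6) * 8 ≤ n → (c * (2 * n)) ^ 6 * Z n ≤ oddDoubleFact n ^ 6
      bound n N≤n = begin
        (c * (2 * n)) ^ 6 * Z n     ≤⟨ Z-bound c {n} {y} 1≤n n<8y ⟩
        A * B ^ y * y ^ (32 * y + 15) ≤⟨ *-monoˡ-≤ (y ^ (32 * y + 15)) (power-dominates A B y (s≤s z≤n) AB≤y) ⟩
        y ^ y * y ^ (32 * y + 15)   ≡⟨ ^-distribˡ-+-* y y (32 * y + 15) ⟨
        y ^ (y + (32 * y + 15))     ≤⟨ ^-monoʳ-≤ y exponent-bound ⟩
        y ^ (7 * j * 6)             ≡⟨ ^-*-assoc y (7 * j) 6 ⟨
        (y ^ (7 * j)) ^ 6           ≤⟨ ^-monoˡ-≤ 6 (oddDoubleFact-≥-eighth {j} {n} (m/n*n≤m n 8)) ⟩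
        oddDoubleFact n ^ 6         ∎
        where
          j = n / 8
          y = suc j
          n<8y : n < y * 8
          n<8y = subst (_< y * 8) (sym (m≡m%n+[m/n]*n n 8)) (+-monoˡ-< (j * 8) (m%n<n n 8))
          AB+6≤j : A * B + 6 ≤ j
          AB+6≤j = subst (_≤ j) (m*n/n≡m (A * B + 6) 8) (/-monoˡ-≤ 8 N≤n)
          AB≤y : A * B ≤ y
          AB≤y = ≤-trans (m≤m+n (A * B) 6) (≤-trans AB+6≤j (n≤1+n j))
          6≤j : 6 ≤ j
          6≤j = ≤-trans (m≤n+m 6 (A * B)) AB+6≤j
          1≤n : 1 ≤ n
          1≤n = ≤-trans (≤-trans (s≤s z≤n) 6≤j) (≤-trans (m≤m*n j 8) (m/n*n≤m n 8))
          exponent-bound : y + (32 * y + 15) ≤ 7 * j * 6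
          exponent-bound = begin
            y + (32 * y + 15)   ≡⟨ collect j ⟩
            33 * j + 48         ≤⟨ +-monoʳ-≤ (33 * j) (≤-trans (m≤m+n 48 6) (*-monoʳ-≤ 9 6≤j)) ⟩
            33 * j + 9 * j      ≡⟨ combine j ⟩
            7 * j * 6           ∎
            where
              collect : ∀ x → suc x + (32 * suc x + 15) ≡ 33 * x + 48
              collect = solve-∀
              combine : ∀ x → 33 * x + 9 * x ≡ 7 * x * 6
              combine = solve-∀

  commutingCount-square : ∀ K → (2 ^ K * involutionCount K) * (2 ^ K * involutionCount K) ≤ (16 * suc K) ^ K
  commutingCount-square K = begin
    (2 ^ K * involutionCount K) * (2 ^ K * involutionCount K)    ≡⟨ square-* (2 ^ K) (involutionCount K) ⟩
    (2 ^ K * 2 ^ K) * (involutionCount K * involutionCount K)    ≤⟨ *-monoʳ-≤ (2 ^ K * 2 ^ K) (involutionCount-square K) ⟩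
    (2 ^ K * 2 ^ K) * (4 ^ K * suc K ^ K)                        ≡⟨ cong (λ z → z * (4 ^ K * suc K ^ K)) (^-distribʳ-* 2 2 K) ⟨
    4 ^ K * (4 ^ K * suc K ^ K)                                  ≡⟨ *-assoc (4 ^ K) (4 ^ K) (suc K ^ K) ⟨
    4 ^ K * 4 ^ K * suc K ^ K                                    ≡⟨ cong (_* suc K ^ K) (^-distribʳ-* 4 4 K) ⟨
    16 ^ K * suc K ^ K                                           ≡⟨ ^-distribʳ-* 16 (suc K) K ⟨
    (16 * suc K) ^ K                                             ∎
    where
      square-* : ∀ x y → (x * y) * (x * y) ≡ (x * x) * (y * y)
      square-* = solve-∀

  commutingTerm-bound : ∀ {n K} → 2 ≤ n → K ≤ suc n → (2 * n * (2 ^ K * involutionCount K)) ^ 6 ≤ Z n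
  commutingTerm-bound {n} {K} 2≤n K≤n+1 = begin
    (a * t) ^ 6                             ≡⟨ ^-distribʳ-* a t 6 ⟩
    a ^ 6 * t ^ 6                           ≡⟨ cong (a ^ 6 *_) (square-sixth t) ⟨
    a ^ 6 * (t * t) ^ 3                     ≤⟨ *-monoʳ-≤ (a ^ 6) (^-monoˡ-≤ 3 (commutingCount-square K)) ⟩
    a ^ 6 * ((16 * suc K) ^ K) ^ 3          ≡⟨ cong (a ^ 6 *_) (^-*-assoc (16 * suc K) K 3) ⟩
    a ^ 6 * (16 * suc K) ^ (K * 3)          ≤⟨ *-monoʳ-≤ (a ^ 6) (^-mono-≤ (s≤s z≤n) (*-monoʳ-≤ 16 K+1≤a) 3K≤3n+3) ⟩
    a ^ 6 * (16 * a) ^ (3 * n + 3)          ≡⟨ cong (a ^ 6 *_) (^-distribʳ-* 16 a (3 * n + 3)) ⟩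
    a ^ 6 * (16 ^ (3 * n + 3) * a ^ (3 * n + 3)) ≡⟨ swap (a ^ 6) (16 ^ (3 * n + 3)) (a ^ (3 * n + 3)) ⟩
    16 ^ (3 * n + 3) * (a ^ 6 * a ^ (3 * n + 3)) ≡⟨ cong (16 ^ (3 * n + 3) *_) (^-distribˡ-+-* a 6 (3 * n + 3)) ⟨
    16 ^ (3 * n + 3) * a ^ (6 + (3 * n + 3)) ≤⟨ *-monoʳ-≤ (16 ^ (3 * n + 3)) (^-monoʳ-≤ a {{a-nonZero}} exponent) ⟩
    Z n                                     ∎
    where
      a = 2 * n
      t = 2 ^ K * involutionCount K
      a-nonZero = >-nonZero (≤-trans (s≤s z≤n) (≤-trans 2≤n (m≤m+n n (n + 0))))
      K+1≤a : suc K ≤ a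
      K+1≤a = ≤-trans (s≤s K≤n+1) (subst₂ _≤_ (+-comm n 2) (cong (n +_) (sym (+-identityʳ n))) (+-monoʳ-≤ n 2≤n))
      3K≤3n+3 : K * 3 ≤ 3 * n + 3
      3K≤3n+3 = subst (K * 3 ≤_) (three n) (*-monoˡ-≤ 3 K≤n+1)
        where three : ∀ x → suc x * 3 ≡ 3 * x + 3
              three = solve-∀
      swap : ∀ x y z → x * (y * z) ≡ y * (x * z)
      swap = solve-∀
      exponent : 6 + (3 * n + 3) ≤ 4 * n + 9
      exponent = subst₂ _≤_ (lhs n) (rhs n) (+-monoˡ-≤ 9 (m≤m+n (3 * n) n))
        where lhs : ∀ x → 3 * x + 9 ≡ 6 + (3 * x + 3)
              lhs = solve-∀
              rhs : ∀ x → 3 * x + x + 9 ≡ 4 * x + 9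
              rhs = solve-∀

  shortRotationTerm-bound : ∀ {n L} → 1 ≤ n → L * 3 ≤ 2 * n → (suc L * (2 * n) ^ L) ^ 6 ≤ Z n
  shortRotationTerm-bound {n} {L} 1≤n 3L≤a = begin
    (suc L * a ^ L) ^ 6            ≡⟨ ^-distribʳ-* (suc L) (a ^ L) 6 ⟩
    suc L ^ 6 * (a ^ L) ^ 6        ≤⟨ *-monoˡ-≤ ((a ^ L) ^ 6) (^-monoˡ-≤ 6 L+1≤a) ⟩
    a ^ 6 * (a ^ L) ^ 6            ≡⟨ cong (a ^ 6 *_) (^-*-assoc a L 6) ⟩
    a ^ 6 * a ^ (L * 6)            ≡⟨ ^-distribˡ-+-* a 6 (L * 6) ⟨
    a ^ (6 + L * 6)                ≤⟨ ^-monoʳ-≤ a {{a-nonZero}} exponent ⟩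
    a ^ (4 * n + 9)                ≤⟨ m≤n*m (a ^ (4 * n + 9)) (16 ^ (3 * n + 3)) {{m^n≢0 16 (3 * n + 3)}} ⟩
    Z n                            ∎
    where
      a = 2 * n
      1≤a = ≤-trans 1≤n (m≤m+n n (n + 0))
      a-nonZero = >-nonZero 1≤a
      successor-bound : ∀ L → L * 3 ≤ a → suc L ≤ a
      successor-bound zero _ = 1≤a
      successor-bound (suc l) 3L≤a = ≤-trans (s≤s (s≤s (≤-trans (m≤m*n l 3) (n≤1+n (l * 3))))) 3L≤a
      L+1≤a : suc L ≤ a
      L+1≤a = successor-bound L 3L≤a
      exponent : 6 + L * 6 ≤ 4 * n + 9
      exponent = begin
        6 + L * 6          ≡⟨ cong (6 +_) (six L) ⟩
        6 + 2 * (L * 3)    ≤⟨ +-monoʳ-≤ 6 (*-monoʳ-≤ 2 3L≤a) ⟩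
        6 + 2 * (2 * n)    ≡⟨ four n ⟩
        4 * n + 6          ≤⟨ +-monoʳ-≤ (4 * n) (m≤m+n 6 3) ⟩
        4 * n + 9          ∎
        where six : ∀ x → x * 6 ≡ 2 * (x * 3)
              six = solve-∀
              four : ∀ x → 6 + 2 * (2 * x) ≡ 4 * x + 6
              four = solve-∀

open import Data.Nat using (_+_; _^_; z≤n; s≤s)
open import Data.Nat.Properties
open import Data.Nat.Tactic.RingSolver using (solve-∀)
open import Data.Product using (_×_; _,_; proj₁; proj₂)
open import Relation.Binary.PropositionalEquality using (sym; cong; subst; subst₂)
open Estimates

open ≤-Reasoning

∣-∣≤ : ∀ {x q s} → q ≤ x → x ≤ q + s → ∣ x - q ∣ ≤ s
∣-∣≤ {x} {q} {s} q≤x x≤q+s = subst (_≤ s) (sym (m≤n⇒∣n-m∣≡n∸m q≤x)) (m≤n+o⇒m∸n≤o x q x≤q+s)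

module _ (n′ : ℕ) (1≤n′ : 1 ≤ n′) where
  open DihedralAction n′ using (m)
  open Stabilisers n′ using (halfTurnCount; vertexReflectionCount; shortRotationCount; L; 3L≤m; stabiliserCodeCount)

  Dominated : ℕ → Set
  Dominated e = (8 * suc e * (2 * suc n′)) ^ 6 * Z (suc n′) ≤ oddDoubleFact (suc n′) ^ 6

  stabiliserCodes-negligible : ∀ e → Dominated e → suc e * (stabiliserCodeCount * (m * 2)) ≤ oddDoubleFact (suc n′)
  stabiliserCodes-negligible e dominated = *-cancelˡ-≤ 4 (begin
    4 * (suc e * (stabiliserCodeCount * (m * 2)))
      ≡⟨ distribute (suc e) m halfTurnCount (m * halfTurnCount) (m * vertexReflectionCount) shortRotationCount ⟩
    T * halfTurnCount + (T * (m * halfTurnCount) + (T * (m * vertexReflectionCount) + T * shortRotationCount))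
      ≤⟨ +-mono-≤ (≤-trans (*-monoʳ-≤ T (m≤n*m halfTurnCount m)) halfTurnTerm)
           (+-mono-≤ halfTurnTerm (+-mono-≤ vertexReflectionTerm shortRotationTerm)) ⟩
    Q + (Q + (Q + Q))
      ≡⟨ four-times Q ⟩
    4 * Q ∎)
    where
      T = 8 * suc e * m
      Q = oddDoubleFact (suc n′)
      2≤n : 2 ≤ suc n′
      2≤n = s≤s 1≤n′
      negligible : ∀ {t} → t ^ 6 ≤ Z (suc n′) → T * t ≤ Q
      negligible {t} t⁶≤Z = sixth-root {T} {t} {Z (suc n′)} {Q} dominated t⁶≤Z
      halfTurnTerm : T * (m * halfTurnCount) ≤ Q
      halfTurnTerm = negligible {m * halfTurnCount} (commutingTerm-bound {suc n′} {suc n′} 2≤n (n≤1+n _))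
      vertexReflectionTerm : T * (m * vertexReflectionCount) ≤ Q
      vertexReflectionTerm = negligible {m * vertexReflectionCount} (commutingTerm-bound {suc n′} {suc (suc n′)} 2≤n ≤-refl)
      shortRotationTerm : T * shortRotationCount ≤ Q
      shortRotationTerm = negligible {shortRotationCount} (shortRotationTerm-bound {suc n′} {L} (s≤s z≤n) 3L≤m)
      distribute : ∀ c m h a b s → 4 * (c * ((h + (a + (b + s))) * (m * 2))) ≡
        8 * c * m * h + (8 * c * m * a + (8 * c * m * b + 8 * c * m * s))
      distribute = solve-∀
      four-times : ∀ q → q + (q + (q + q)) ≡ 4 * q
      four-times = solve-∀

  classCount-bounds : ∀ d → ClassCount (suc n′) d →
    oddDoubleFact (suc n′) ≤ 4 * suc n′ * d × 4 * suc n′ * d ≤ oddDoubleFact (suc n′) + stabiliserCodeCount * (m * 2)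
  classCount-bounds d classes =
    subst₂ _≤_ (matchingCount-double (suc n′)) (count d) matchingCount≤ ,
    subst₂ _≤_ (count d) (cong (_+ stabiliserCodeCount * (m * 2)) (matchingCount-double (suc n′))) ≤labelCount
    where
      open ClassBounds n′ 1≤n′ d classes using (matchingCount≤; ≤labelCount)
      count : ∀ d → d * (m * 2) ≡ 4 * suc n′ * d
      count d = rearrange d (suc n′)
        where rearrange : ∀ d n → d * (2 * n * 2) ≡ 4 * n * d
              rearrange = solve-∀

  classCount-close : ∀ e → Dominated e → ∀ d → ClassCount (suc n′) d →
    suc e * ∣ 4 * suc n′ * d - oddDoubleFact (suc n′) ∣ ≤ oddDoubleFact (suc n′)
  classCount-close e dominated d classes = ≤-trans (*-monoʳ-≤ (suc e) (∣-∣≤ lower upper)) (stabiliserCodes-negligible e dominated)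
    where
      lower = proj₁ (classCount-bounds d classes)
      upper = proj₂ (classCount-bounds d classes)

eventually-close : ∀ e → (∃ λ N → ∀ n → N ≤ n → (8 * suc e * (2 * n)) ^ 6 * Z n ≤ oddDoubleFact n ^ 6) →
  ∃ λ (N : ℕ) → (n : ℕ) → N ≤ n → (k : ℕ) → ClassCount n k → suc e * ∣ 4 * n * k - oddDoubleFact n ∣ ≤ oddDoubleFact n
eventually-close e (N , dominated) = N + 2 , bound
  where
    bound : (n : ℕ) → N + 2 ≤ n → (k : ℕ) → ClassCount n k → suc e * ∣ 4 * n * k - oddDoubleFact n ∣ ≤ oddDoubleFact n
    bound (suc n′@(suc _)) N+2≤n = classCount-close n′ (s≤s z≤n) e (dominated (suc n′) (≤-trans (m≤m+n N 2) N+2≤n))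
    bound 0 N+2≤n with () ← ≤-trans (m≤n+m 2 N) N+2≤n
    bound 1 N+2≤n with s≤s () ← ≤-trans (m≤n+m 2 N) N+2≤n

corollary2 : (e : ℕ) → ∃ λ (N : ℕ) → (n : ℕ) → N ≤ n → (k : ℕ) → ClassCount n k →
    suc e * ∣ 4 * n * k - oddDoubleFact n ∣ ≤ oddDoubleFact n
corollary2 e = eventually-close e (oddDoubleFact-dominates (8 * suc e))
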